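{- Let $\mathcal{E}$ be the set of $\mathbf{x}\in\mathbb{Z}^4$ with $\gcd(x_0,\dots,x_3)=1$, $x_0x_1x_2x_3\ne0$, $x_0,x_2>0$ and $x_1x_2^2+x_2x_0^2+x_3^3=0$. Let $\mathcal{T}_2$ be the set of $(\xi_1,\xi_2,\xi_3,\xi_\ell,\xi_4,\xi_5,\xi_6,\tau_1,\tau_2,\tau_\ell)\in\mathbb{N}^7\times\mathbb{Z}_*\times\mathbb{N}\times\mathbb{Z}_*$ satisfying $$\tau_\ell\xi_\ell^3\xi_4^2\xi_5+\tau_2^2\xi_2+\tau_1^3\xi_1^2\xi_3=0,$$ $\gcd(\tau_2,\xi_1\xi_3)=\gcd(\tau_\ell,\xi_4\xi_5\xi_6)=1$, $\xi_2\xi_3\xi_4\xi_5$ squarefree, $\gcd(\xi_1,\xi_2)=1$, and $\gcd(\tau_1,\xi_2\xi_3\xi_\ell\xi_4\xi_5\xi_6)=1$. Define $$\Psi(\boldsymbol{\xi},\boldsymbol{\tau})=\big(\xi_1\xi_2^2\xi_3^2\xi_4\xi_5^2\xi_6^3\tau_2,\ \tau_\ell,\ \xi_1^2\xi_2^3\xi_3^4\xi_\ell^3\xi_4^4\xi_5^5\xi_6^6,\ \xi_1^2\xi_2^2\xi_3^3\xi_\ell\xi_4^2\xi_5^3\xi_6^4\tau_1\big).$$ Then $\Psi$ restricts to a bijection from $\mathcal{T}_2$ onto $\mathcal{E}$.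
   Context: $\mathbb{N}$ denotes the positive integers and $\mathbb{Z}_*$ the nonzero integers. -}

module Defs where

open import Data.Nat using (ℕ)
open import Data.Integer using (ℤ; +_; 0ℤ; 1ℤ; _+_; _*_; _^_; _<_; ∣_∣)
open import Data.Integer.GCD using (gcd)
open import Data.Integer.Divisibility using (_∣_)
open import Data.Product using (_×_)
open import Relation.Binary.PropositionalEquality using (_≡_; _≢_)

record ℤ⁴ : Set where
  constructor ⟨_,_,_,_⟩
  field x₀ x₁ x₂ x₃ : ℤ

-- the parameter tuple (ξ₁,ξ₂,ξ₃,ξℓ,ξ₄,ξ₅,ξ₆,τ₁,τ₂,τℓ), all stored as integers;
-- membership in ℕ⁷ × ℤ_* × ℕ × ℤ_* is imposed in 𝒯₂
record Param : Set where
  constructor param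
  field ξ₁ ξ₂ ξ₃ ξℓ ξ₄ ξ₅ ξ₆ τ₁ τ₂ τℓ : ℤ

SquareFree : ℤ → Set
SquareFree n = ∀ (d : ℤ) → (d * d) ∣ n → ∣ d ∣ ≡ 1

gcd4 : ℤ → ℤ → ℤ → ℤ → ℤ
gcd4 a b c d = gcd (gcd (gcd a b) c) d

𝓔 : ℤ⁴ → Set
𝓔 ⟨ x₀ , x₁ , x₂ , x₃ ⟩ =
  gcd4 x₀ x₁ x₂ x₃ ≡ 1ℤ
  × (x₀ * x₁ * x₂ * x₃) ≢ 0ℤ
  × 0ℤ < x₀ × 0ℤ < x₂
  × x₁ * x₂ ^ 2 + x₂ * x₀ ^ 2 + x₃ ^ 3 ≡ 0ℤ

𝓣₂ : Param → Set
𝓣₂ (param ξ₁ ξ₂ ξ₃ ξℓ ξ₄ ξ₅ ξ₆ τ₁ τ₂ τℓ) =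
  (0ℤ < ξ₁ × 0ℤ < ξ₂ × 0ℤ < ξ₃ × 0ℤ < ξℓ × 0ℤ < ξ₄ × 0ℤ < ξ₅ × 0ℤ < ξ₆)
  × τ₁ ≢ 0ℤ × 0ℤ < τ₂ × τℓ ≢ 0ℤ
  × τℓ * ξℓ ^ 3 * ξ₄ ^ 2 * ξ₅ + τ₂ ^ 2 * ξ₂ + τ₁ ^ 3 * ξ₁ ^ 2 * ξ₃ ≡ 0ℤ
  × gcd τ₂ (ξ₁ * ξ₃) ≡ 1ℤ
  × gcd τℓ (ξ₄ * ξ₅ * ξ₆) ≡ 1ℤ
  × SquareFree (ξ₂ * ξ₃ * ξ₄ * ξ₅)
  × gcd ξ₁ ξ₂ ≡ 1ℤ
  × gcd τ₁ (ξ₂ * ξ₃ * ξℓ * ξ₄ * ξ₅ * ξ₆) ≡ 1ℤ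

Ψ : Param → ℤ⁴
Ψ (param ξ₁ ξ₂ ξ₃ ξℓ ξ₄ ξ₅ ξ₆ τ₁ τ₂ τℓ) =
  ⟨ ξ₁ * ξ₂ ^ 2 * ξ₃ ^ 2 * ξ₄ * ξ₅ ^ 2 * ξ₆ ^ 3 * τ₂
  , τℓ
  , ξ₁ ^ 2 * ξ₂ ^ 3 * ξ₃ ^ 4 * ξℓ ^ 3 * ξ₄ ^ 4 * ξ₅ ^ 5 * ξ₆ ^ 6
  , ξ₁ ^ 2 * ξ₂ ^ 2 * ξ₃ ^ 3 * ξℓ * ξ₄ ^ 2 * ξ₅ ^ 3 * ξ₆ ^ 4 * τ₁ ⟩

module Submission where

-- Everything is decided one prime p at a time. The valuations at p of ξ and τ determine those
-- of Ψ(ξ, τ) linearly. The gcd and squarefree conditions of 𝓣₂, together with the fact that in a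
-- vanishing sum of three terms the smallest valuation is attained twice, leave six local shapes,
-- and on each of them the valuations of ξ are read back from those of Ψ(ξ, τ) (recover). Conversely,
-- at every prime the conditions of 𝓔 (one coordinate is prime to p, and the smallest valuation among
-- x₁x₂², x₂x₀², x₃³ is attained twice) are met exactly by the images of these shapes (Preimage).
-- Injectivity follows since positive integers with equal valuations are equal, after which τ₁ and
-- τ₂ cancel. For surjectivity, each ξᵢ is built as a product of prime powers with the recovered
-- valuations, τ₂ and τ₁ are the cofactors of x₀ and x₃, and the identity
-- x₁x₂² + x₂x₀² + x₃³ = K · (τℓξℓ³ξ₄²ξ₅ + τ₂²ξ₂ + τ₁³ξ₁²ξ₃) transports the defining equations.

module Valuation where

  open import Data.Nat
  open import Data.Nat.Properties
  open import Data.Nat.Divisibility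
  open import Data.Nat.GCD using (gcd; gcd[m,n]∣m; gcd[m,n]∣n; gcd-greatest; gcd[m,n]≡0⇒m≡0)
  open import Data.Nat.Primality
  open import Data.Nat.Primality.Factorisation using (factorise; PrimeFactorisation)
  open import Data.Nat.ListAction using (product)
  open import Data.Nat.Induction using (<-wellFounded)
  open import Induction.WellFounded using (Acc; acc)
  open import Data.List using ([]; _∷_)
  open import Data.List.Relation.Unary.All using (All; []; _∷_)
  open import Data.Product using (∃; _×_; _,_; proj₁; proj₂)
  open import Data.Sum using (_⊎_; inj₁; inj₂; [_,_]′)
  open import Data.Empty using (⊥-elim)
  open import Relation.Nullary using (yes; no)
  open import Relation.Binary.PropositionalEquality
  open import Algebra.Properties.CommutativeSemigroup *-commutativeSemigroup using (interchange)

  νᶠ : ℕ → ℕ → ℕ → ℕ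
  νᶠ zero    p n = 0
  νᶠ (suc k) p n with p ∣? n
  ... | no _              = 0
  ... | yes (divides q _) = suc (νᶠ k p q)

  -- The fuel n suffices since each step divides n by p; ν p 0 = 0 is a junk value.
  ν : ℕ → ℕ → ℕ
  ν p n = νᶠ n p n

  νᶠ-spec : ∀ {p} k n → 1 < p → 0 < n → n ≤ k → p ^ νᶠ k p n ∣ n × p ^ suc (νᶠ k p n) ∤ n
  νᶠ-spec zero    n 1<p 0<n n≤0 = ⊥-elim (<⇒≱ 0<n n≤0)
  νᶠ-spec {p} (suc k) n 1<p 0<n n≤1+k with p ∣? n
  ... | no p∤n = 1∣ n , λ p^1∣n → p∤n (subst (_∣ n) (*-identityʳ p) p^1∣n)
  ... | yes (divides q n≡qp) = p^1+ν∣n , p^2+ν∤n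
    where
    instance _ = ≢-nonZero λ { refl → <⇒≢ 0<n (sym n≡qp) }
    q<n : q < n
    q<n = subst (q <_) (sym n≡qp) (m<m*n q p 1<p)
    n≡pq : n ≡ p * q
    n≡pq = trans n≡qp (*-comm q p)
    IH = νᶠ-spec k q 1<p (>-nonZero⁻¹ q) (≤-pred (≤-trans q<n n≤1+k))
    p^1+ν∣n : p ^ suc (νᶠ k p q) ∣ n
    p^1+ν∣n = subst (_ ∣_) (sym n≡pq) (*-monoʳ-∣ p (proj₁ IH))
    p^2+ν∤n : p ^ suc (suc (νᶠ k p q)) ∤ n
    p^2+ν∤n h = proj₂ IH (*-cancelˡ-∣ p {{>-nonZero (<-trans z<s 1<p)}} (subst (_ ∣_) n≡pq h))

  m*n>0⇒m>0 : ∀ m {n} → 0 < m * n → 0 < m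
  m*n>0⇒m>0 (suc m) _ = z<s

  ^-mono-∣ : ∀ p {k j} → k ≤ j → p ^ k ∣ p ^ j
  ^-mono-∣ p {k} {j} k≤j = divides (p ^ (j ∸ k)) (begin
    p ^ j               ≡⟨ cong (p ^_) (m∸n+n≡m k≤j) ⟨
    p ^ (j ∸ k + k)     ≡⟨ ^-distribˡ-+-* p (j ∸ k) k ⟩
    p ^ (j ∸ k) * p ^ k ∎)
    where open ≡-Reasoning

  gcd>0 : ∀ {m n} → 0 < m → 0 < gcd m n
  gcd>0 0<m = n≢0⇒n>0 λ gcd≡0 → <⇒≢ 0<m (sym (gcd[m,n]≡0⇒m≡0 gcd≡0))

  module _ {p : ℕ} (p-prime : Prime p) where

    1<p : 1 < p
    1<p = nonTrivial⇒n>1 p {{prime⇒nonTrivial p-prime}}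

    private instance
      p≢0 : NonZero p
      p≢0 = prime⇒nonZero p-prime

    p^ν∣n : ∀ {n} → 0 < n → p ^ ν p n ∣ n
    p^ν∣n {n} 0<n = proj₁ (νᶠ-spec n n 1<p 0<n ≤-refl)

    p^1+ν∤n : ∀ {n} → 0 < n → p ^ suc (ν p n) ∤ n
    p^1+ν∤n {n} 0<n = proj₂ (νᶠ-spec n n 1<p 0<n ≤-refl)

    p^k∣n⇒k≤ν : ∀ {n k} → 0 < n → p ^ k ∣ n → k ≤ ν p n
    p^k∣n⇒k≤ν {n} {k} 0<n p^k∣n with k ≤? ν p n
    ... | yes k≤ν = k≤ν
    ... | no  k≰ν = ⊥-elim (p^1+ν∤n 0<n (∣-trans (^-mono-∣ p (≰⇒> k≰ν)) p^k∣n))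

    k≤ν⇒p^k∣n : ∀ {n k} → 0 < n → k ≤ ν p n → p ^ k ∣ n
    k≤ν⇒p^k∣n 0<n k≤ν = ∣-trans (^-mono-∣ p k≤ν) (p^ν∣n 0<n)

    ν-unique : ∀ {n k} → 0 < n → p ^ k ∣ n → p ^ suc k ∤ n → ν p n ≡ k
    ν-unique 0<n p^k∣n p^1+k∤n =
      ≤-antisym (≮⇒≥ λ k<ν → p^1+k∤n (k≤ν⇒p^k∣n 0<n k<ν)) (p^k∣n⇒k≤ν 0<n p^k∣n)

    ∣⇒ν>0 : ∀ {n} → 0 < n → p ∣ n → 0 < ν p n
    ∣⇒ν>0 0<n p∣n = p^k∣n⇒k≤ν 0<n (subst (_∣ _) (sym (*-identityʳ p)) p∣n)

    ν>0⇒∣ : ∀ {n} → 0 < n → 0 < ν p n → p ∣ n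
    ν>0⇒∣ 0<n ν>0 = subst (_∣ _) (*-identityʳ p) (k≤ν⇒p^k∣n 0<n ν>0)

    ∤⇒ν≡0 : ∀ {n} → 0 < n → p ∤ n → ν p n ≡ 0
    ∤⇒ν≡0 0<n p∤n = n≤0⇒n≡0 (≮⇒≥ λ ν>0 → p∤n (ν>0⇒∣ 0<n ν>0))

    n≡p^ν*unit : ∀ {n} → 0 < n → ∃ λ n′ → n ≡ p ^ ν p n * n′ × p ∤ n′
    n≡p^ν*unit {n} 0<n with p^ν∣n 0<n
    ... | divides n′ n≡n′p^ν = n′ , trans n≡n′p^ν (*-comm n′ _) , p∤n′
      where
      p∤n′ : p ∤ n′
      p∤n′ (divides r n′≡rp) = p^1+ν∤n 0<n (divides r (begin
        n                     ≡⟨ n≡n′p^ν ⟩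
        n′ * p ^ ν p n        ≡⟨ cong (_* p ^ ν p n) n′≡rp ⟩
        r * p * p ^ ν p n     ≡⟨ *-assoc r p _ ⟩
        r * p ^ suc (ν p n)   ∎))
        where open ≡-Reasoning

    ν-* : ∀ {m n} → 0 < m → 0 < n → ν p (m * n) ≡ ν p m + ν p n
    ν-* {m} {n} 0<m 0<n with n≡p^ν*unit 0<m | n≡p^ν*unit 0<n
    ... | m′ , m≡ , p∤m′ | n′ , n≡ , p∤n′ = ν-unique (*-mono-< 0<m 0<n) p^a+b∣mn p^1+a+b∤mn
      where
      a = ν p m
      b = ν p n
      mn≡ : m * n ≡ p ^ (a + b) * (m′ * n′)
      mn≡ = begin
        m * n                           ≡⟨ cong₂ _*_ m≡ n≡ ⟩
        (p ^ a * m′) * (p ^ b * n′)     ≡⟨ interchange (p ^ a) m′ (p ^ b) n′ ⟩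
        (p ^ a * p ^ b) * (m′ * n′)     ≡⟨ cong (_* (m′ * n′)) (^-distribˡ-+-* p a b) ⟨
        p ^ (a + b) * (m′ * n′)         ∎
        where open ≡-Reasoning
      p^a+b∣mn : p ^ (a + b) ∣ m * n
      p^a+b∣mn = subst (p ^ (a + b) ∣_) (sym mn≡) (m∣m*n (m′ * n′))
      p^1+a+b∤mn : p ^ suc (a + b) ∤ m * n
      p^1+a+b∤mn h = [ p∤m′ , p∤n′ ]′ (euclidsLemma m′ n′ p-prime
        (*-cancelˡ-∣ (p ^ (a + b)) {{m^n≢0 p (a + b)}} (subst₂ _∣_ (*-comm p _) mn≡ h)))

    ν[1]≡0 : ν p 1 ≡ 0
    ν[1]≡0 = ∤⇒ν≡0 z<s λ p∣1 → <⇒≢ 1<p (sym (∣1⇒≡1 p∣1))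

    ν-^ : ∀ {m} k → 0 < m → ν p (m ^ k) ≡ k * ν p m
    ν-^ zero    0<m = ν[1]≡0
    ν-^ {m} (suc k) 0<m = begin
      ν p (m * m ^ k)       ≡⟨ ν-* 0<m (m^n>0 m {{>-nonZero 0<m}} k) ⟩
      ν p m + ν p (m ^ k)   ≡⟨ cong (ν p m +_) (ν-^ k 0<m) ⟩
      ν p m + k * ν p m     ∎
      where open ≡-Reasoning

    ν[p]≡1 : ν p p ≡ 1
    ν[p]≡1 = ν-unique (>-nonZero⁻¹ p) (subst (_∣ p) (sym (*-identityʳ p)) ∣-refl)
      λ p²∣p → <⇒≱ (m<m*n p p 1<p) (∣⇒≤ (subst (_∣ p) (cong (p *_) (*-identityʳ p)) p²∣p))

    ν[p^k]≡k : ∀ k → ν p (p ^ k) ≡ k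
    ν[p^k]≡k k = trans (ν-^ k (>-nonZero⁻¹ p)) (trans (cong (k *_) ν[p]≡1) (*-identityʳ k))

    ν-gcd : ∀ {m n} → 0 < m → 0 < n → ν p (gcd m n) ≡ ν p m ⊓ ν p n
    ν-gcd {m} {n} 0<m 0<n = ν-unique (gcd>0 0<m) p^k∣gcd p^1+k∤gcd
      where
      k = ν p m ⊓ ν p n
      p^k∣gcd : p ^ k ∣ gcd m n
      p^k∣gcd = gcd-greatest (k≤ν⇒p^k∣n 0<m (m⊓n≤m (ν p m) (ν p n))) (k≤ν⇒p^k∣n 0<n (m⊓n≤n (ν p m) (ν p n)))
      p^1+k∤gcd : p ^ suc k ∤ gcd m n
      p^1+k∤gcd h = <-irrefl refl (⊓-glb (p^k∣n⇒k≤ν 0<m (∣-trans h (gcd[m,n]∣m m n)))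
                                         (p^k∣n⇒k≤ν 0<n (∣-trans h (gcd[m,n]∣n m n))))

    ν[q^k]≡0 : ∀ {q} k → Prime q → q ≢ p → ν p (q ^ k) ≡ 0
    ν[q^k]≡0 {q} k q-prime q≢p = ∤⇒ν≡0 (m^n>0 q {{prime⇒nonZero q-prime}} k) (p∤q^ k)
      where
      p∤q^ : ∀ k → p ∤ q ^ k
      p∤q^ zero p∣1 = <⇒≢ 1<p (sym (∣1⇒≡1 p∣1))
      p∤q^ (suc k) p∣q^1+k with euclidsLemma q (q ^ k) p-prime p∣q^1+k
      ... | inj₂ p∣q^k = p∤q^ k p∣q^k
      ... | inj₁ p∣q with prime⇒irreducible q-prime p∣q
      ...   | inj₁ refl = <-irrefl refl 1<p
      ...   | inj₂ refl = q≢p refl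

  ∃-prime-∣ : ∀ {n} → 1 < n → ∃ λ p → Prime p × p ∣ n
  ∃-prime-∣ {n} 1<n = first (PrimeFactorisation.isFactorisation F) (PrimeFactorisation.factorsPrime F)
    where
    instance _ = >-nonZero (<-trans z<s 1<n)
    F = factorise n
    first : ∀ {ps} → n ≡ product ps → All Prime ps → ∃ λ p → Prime p × p ∣ n
    first {[]}     n≡1 []            = ⊥-elim (<⇒≢ 1<n (sym n≡1))
    first {p ∷ ps} n≡p*ps (p-prime ∷ _) = p , p-prime , divides (product ps) (trans n≡p*ps (*-comm p _))

  ∣-by-ν : ∀ {m n} → 0 < m → 0 < n → (∀ p → Prime p → ν p m ≤ ν p n) → m ∣ n
  ∣-by-ν {m} = go m (<-wellFounded m)
    where
    go : ∀ m → Acc _<_ m → ∀ {n} → 0 < m → 0 < n → (∀ p → Prime p → ν p m ≤ ν p n) → m ∣ n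
    go 1 _ {n} _ _ _ = 1∣ n
    go (suc (suc k)) (acc rec) {n} 0<m 0<n ν≤ν
      with ∃-prime-∣ {suc (suc k)} (s≤s (s≤s z≤n))
    ... | p , p-prime , divides m′ m≡m′p
      with k≤ν⇒p^k∣n p-prime 0<n (≤-trans (∣⇒ν>0 p-prime 0<m (divides m′ m≡m′p)) (ν≤ν p p-prime))
    ... | divides n′ n≡n′p¹ = subst₂ _∣_ (sym m≡m′p) (sym n≡n′p) (*-monoˡ-∣ p m′∣n′)
      where
      instance _ = prime⇒nonZero p-prime
      n≡n′p : n ≡ n′ * p
      n≡n′p = trans n≡n′p¹ (cong (n′ *_) (*-identityʳ p))
      0<m′ : 0 < m′
      0<m′ = m*n>0⇒m>0 m′ (subst (0 <_) m≡m′p 0<m)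
      0<n′ : 0 < n′
      0<n′ = m*n>0⇒m>0 n′ (subst (0 <_) n≡n′p 0<n)
      m′<m : m′ < suc (suc k)
      m′<m = subst (m′ <_) (sym m≡m′p) (m<m*n m′ p {{>-nonZero 0<m′}} (1<p p-prime))
      ν≤ν′ : ∀ q → Prime q → ν q m′ ≤ ν q n′
      ν≤ν′ q q-prime = +-cancelˡ-≤ (ν q p) _ _ (subst₂ _≤_
        (trans (cong (ν q) (trans m≡m′p (*-comm m′ p))) (ν-* q-prime (>-nonZero⁻¹ p) 0<m′))
        (trans (cong (ν q) (trans n≡n′p (*-comm n′ p))) (ν-* q-prime (>-nonZero⁻¹ p) 0<n′))
        (ν≤ν q q-prime))
      m′∣n′ : m′ ∣ n′
      m′∣n′ = go m′ (rec m′<m) 0<m′ 0<n′ ν≤ν′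

  ≡-by-ν : ∀ {m n} → 0 < m → 0 < n → (∀ p → Prime p → ν p m ≡ ν p n) → m ≡ n
  ≡-by-ν 0<m 0<n ν≡ν = ∣-antisym (∣-by-ν 0<m 0<n λ p p-prime → ≤-reflexive (ν≡ν p p-prime))
                                 (∣-by-ν 0<n 0<m λ p p-prime → ≤-reflexive (sym (ν≡ν p p-prime)))

  ≡1⇒ν≡0 : ∀ {n} → n ≡ 1 → ∀ p → Prime p → ν p n ≡ 0
  ≡1⇒ν≡0 refl p p-prime = ν[1]≡0 p-prime

  ν≡0⇒≡1 : ∀ {n} → 0 < n → (∀ p → Prime p → ν p n ≡ 0) → n ≡ 1
  ν≡0⇒≡1 0<n ν≡0 = ≡-by-ν 0<n z<s λ p p-prime → trans (ν≡0 p p-prime) (sym (ν[1]≡0 p-prime))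

  ∏-prime-powers : (ℕ → ℕ) → ℕ → ℕ
  ∏-prime-powers f zero = 1
  ∏-prime-powers f (suc N) with prime? (suc N)
  ... | yes _ = suc N ^ f (suc N) * ∏-prime-powers f N
  ... | no  _ = ∏-prime-powers f N

  ∏-prime-powers>0 : ∀ f N → 0 < ∏-prime-powers f N
  ∏-prime-powers>0 f zero = z<s
  ∏-prime-powers>0 f (suc N) with prime? (suc N)
  ... | yes _ = *-mono-< (m^n>0 (suc N) (f (suc N))) (∏-prime-powers>0 f N)
  ... | no  _ = ∏-prime-powers>0 f N

  module _ {q : ℕ} (q-prime : Prime q) (f : ℕ → ℕ) where

    ν-∏-prime-powers-out : ∀ N → N < q → ν q (∏-prime-powers f N) ≡ 0
    ν-∏-prime-powers-out zero _ = ν[1]≡0 q-prime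
    ν-∏-prime-powers-out (suc N) N<q with prime? (suc N)
    ... | no  _ = ν-∏-prime-powers-out N (<-trans (n<1+n N) N<q)
    ... | yes N-prime = begin
      ν q (suc N ^ f (suc N) * ∏-prime-powers f N)            ≡⟨ ν-* q-prime (m^n>0 (suc N) (f (suc N))) (∏-prime-powers>0 f N) ⟩
      ν q (suc N ^ f (suc N)) + ν q (∏-prime-powers f N)      ≡⟨ cong₂ _+_ (ν[q^k]≡0 q-prime (f (suc N)) N-prime (<⇒≢ N<q))
                                                                          (ν-∏-prime-powers-out N (<-trans (n<1+n N) N<q)) ⟩
      0                                                       ∎
      where open ≡-Reasoning

    ν-∏-prime-powers-in : ∀ N → q ≤ N → ν q (∏-prime-powers f N) ≡ f q
    ν-∏-prime-powers-in zero q≤0 = ⊥-elim (<⇒≱ (1<p q-prime) (≤-trans q≤0 z≤n))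
    ν-∏-prime-powers-in (suc N) q≤1+N with prime? (suc N) | m≤n⇒m<n∨m≡n q≤1+N
    ... | no N-composite | inj₂ refl = ⊥-elim (N-composite q-prime)
    ... | no  _ | inj₁ q<1+N = ν-∏-prime-powers-in N (≤-pred q<1+N)
    ... | yes N-prime | q≤N = begin
      ν q (suc N ^ f (suc N) * ∏-prime-powers f N)            ≡⟨ ν-* q-prime (m^n>0 (suc N) (f (suc N))) (∏-prime-powers>0 f N) ⟩
      ν q (suc N ^ f (suc N)) + ν q (∏-prime-powers f N)      ≡⟨ split q≤N ⟩
      f q                                                     ∎
      where
      open ≡-Reasoning
      split : q < suc N ⊎ q ≡ suc N → ν q (suc N ^ f (suc N)) + ν q (∏-prime-powers f N) ≡ f q
      split (inj₁ q<1+N) = cong₂ _+_ (ν[q^k]≡0 q-prime (f (suc N)) N-prime (λ { refl → <-irrefl refl q<1+N }))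
                                     (ν-∏-prime-powers-in N (≤-pred q<1+N))
      split (inj₂ refl) = trans (cong₂ _+_ (ν[p^k]≡k q-prime (f q)) (ν-∏-prime-powers-out N (n<1+n N))) (+-identityʳ (f q))

  ∃-with-valuations : ∀ (f : ℕ → ℕ) N → (∀ q → Prime q → N < q → f q ≡ 0) →
                      ∃ λ n → 0 < n × ∀ q → Prime q → ν q n ≡ f q
  ∃-with-valuations f N f≡0 = ∏-prime-powers f N , ∏-prime-powers>0 f N , ν≡f
    where
    ν≡f : ∀ q → Prime q → ν q (∏-prime-powers f N) ≡ f q
    ν≡f q q-prime with q ≤? N
    ... | yes q≤N = ν-∏-prime-powers-in q-prime f N q≤N
    ... | no  q≰N = trans (ν-∏-prime-powers-out q-prime f N (≰⇒> q≰N)) (sym (f≡0 q q-prime (≰⇒> q≰N)))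

  module _ {n : ℕ} (0<n : 0 < n) where

    squarefree⇒ν≤1 : (∀ d → d * d ∣ n → d ≡ 1) → ∀ p → Prime p → ν p n ≤ 1
    squarefree⇒ν≤1 squarefree p p-prime with ν p n ≤? 1
    ... | yes ν≤1 = ν≤1
    ... | no  ν≰1 = ⊥-elim (<⇒≢ (1<p p-prime) (sym (squarefree p p²∣n)))
      where
      p²∣n : p * p ∣ n
      p²∣n = subst (_∣ n) (cong (p *_) (*-identityʳ p)) (k≤ν⇒p^k∣n p-prime 0<n (≰⇒> ν≰1))

    ν≤1⇒squarefree : (∀ p → Prime p → ν p n ≤ 1) → ∀ d → d * d ∣ n → d ≡ 1
    ν≤1⇒squarefree ν≤1 0 0∣n = ⊥-elim (<⇒≢ 0<n (sym (0∣⇒≡0 0∣n)))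
    ν≤1⇒squarefree ν≤1 1 _   = refl
    ν≤1⇒squarefree ν≤1 (suc (suc d)) d²∣n with ∃-prime-∣ {suc (suc d)} (s≤s (s≤s z≤n))
    ... | q , q-prime , q∣d = ⊥-elim (<⇒≱ (s≤s (s≤s z≤n)) (≤-trans (p^k∣n⇒k≤ν q-prime {k = 2} 0<n q²∣n) (ν≤1 q q-prime)))
      where
      q²∣n : q ^ 2 ∣ n
      q²∣n = ∣-trans (subst (_∣ suc (suc d) * suc (suc d)) (cong (q *_) (sym (*-identityʳ q))) (*-pres-∣ q∣d q∣d)) d²∣n

  ν-large : ∀ {p n} → 0 < n → n < p → ν p n ≡ 0
  ν-large {p} {suc k} _ n<p with p ∣? suc k
  ... | no  _   = refl
  ... | yes p∣n = ⊥-elim (>⇒∤ n<p p∣n)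

module LocalExponents where

  open import Data.Nat
  open import Data.Nat.Properties
  open import Data.Nat.DivMod
  open import Data.Nat.Divisibility using (divides; quotient; ∣m+n∣m⇒∣n; m∣n⇒n≡quotient*m)
  open import Data.Nat.Tactic.RingSolver using (solve-∀)
  open import Data.Product using (_×_; _,_; proj₁; proj₂; ∃₂)
  open import Data.Empty using (⊥; ⊥-elim)
  open import Relation.Nullary using (yes; no)
  open import Relation.Binary.Definitions using (tri<; tri≈; tri>)
  open import Relation.Binary.PropositionalEquality

  record NoStrictMin (x y z : ℕ) : Set where
    constructor noStrictMin
    field
      x-not-min : x < y → x < z → ⊥
      y-not-min : y < x → y < z → ⊥
      z-not-min : z < x → z < y → ⊥
  open NoStrictMin public

  noStrictMin-resp : ∀ {x y z x′ y′ z′} → x ≡ x′ → y ≡ y′ → z ≡ z′ → NoStrictMin x y z → NoStrictMin x′ y′ z′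
  noStrictMin-resp refl refl refl T = T

  y<x⇒z≡y : ∀ {x y z} → NoStrictMin x y z → y < x → z ≡ y
  y<x⇒z≡y {x} {y} {z} T y<x with <-cmp z y
  ... | tri< z<y _ _ = ⊥-elim (z-not-min T (<-trans z<y y<x) z<y)
  ... | tri≈ _ z≡y _ = z≡y
  ... | tri> _ _ y<z = ⊥-elim (y-not-min T y<x y<z)

  x<y⇒z≡x : ∀ {x y z} → NoStrictMin x y z → x < y → z ≡ x
  x<y⇒z≡x {x} {y} {z} T x<y with <-cmp z x
  ... | tri< z<x _ _ = ⊥-elim (z-not-min T z<x (<-trans z<x x<y))
  ... | tri≈ _ z≡x _ = z≡x
  ... | tri> _ _ x<z = ⊥-elim (x-not-min T x<y x<z)

  -- Valuations at a fixed prime p: e collects those of ξ₁, ξ₂, ξ₃, ξℓ, ξ₄, ξ₅, ξ₆ and t₁, t₂, tℓ those of τ₁, τ₂, τℓ,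
  -- so that Ψ has valuations (A, B, U, C) = (exp₀ e + t₂, tℓ, exp₂ e, exp₃ e + t₁).
  record Exponents : Set where
    constructor exps
    field e₁ e₂ e₃ eℓ e₄ e₅ e₆ : ℕ

  exp₀ exp₂ exp₃ : Exponents → ℕ
  exp₀ (exps e₁ e₂ e₃ eℓ e₄ e₅ e₆) = e₁ + 2 * e₂ + 2 * e₃ + e₄ + 2 * e₅ + 3 * e₆
  exp₂ (exps e₁ e₂ e₃ eℓ e₄ e₅ e₆) = 2 * e₁ + 3 * e₂ + 4 * e₃ + 3 * eℓ + 4 * e₄ + 5 * e₅ + 6 * e₆
  exp₃ (exps e₁ e₂ e₃ eℓ e₄ e₅ e₆) = 2 * e₁ + 2 * e₂ + 3 * e₃ + eℓ + 2 * e₄ + 3 * e₅ + 4 * e₆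

  Coprimality : Exponents → ℕ → ℕ → ℕ → Set
  Coprimality (exps e₁ e₂ e₃ eℓ e₄ e₅ e₆) t₁ t₂ tℓ =
    t₂ ⊓ (e₁ + e₃) ≡ 0 × tℓ ⊓ (e₄ + e₅ + e₆) ≡ 0 × e₂ + e₃ + e₄ + e₅ ≤ 1
    × e₁ ⊓ e₂ ≡ 0 × t₁ ⊓ (e₂ + e₃ + eℓ + e₄ + e₅ + e₆) ≡ 0

  TorsorValuations : Exponents → ℕ → ℕ → ℕ → Set
  TorsorValuations (exps e₁ e₂ e₃ eℓ e₄ e₅ e₆) t₁ t₂ tℓ =
    NoStrictMin (tℓ + 3 * eℓ + 2 * e₄ + e₅) (2 * t₂ + e₂) (3 * t₁ + 2 * e₁ + e₃)

  SurfaceValuations : ℕ → ℕ → ℕ → ℕ → Set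
  SurfaceValuations A B U C = A ⊓ B ⊓ U ⊓ C ≡ 0 × NoStrictMin (B + 2 * U) (U + 2 * A) (3 * C)

  -- The local shapes of a point of 𝓣₂ at a prime p, according to which terms of
  -- τℓ ξℓ³ ξ₄² ξ₅ + τ₂² ξ₂ + τ₁³ ξ₁² ξ₃ are divisible by p.
  data Shape : Exponents → ℕ → ℕ → ℕ → Set where
    p∣τℓ       : ∀ t₁ t₂ tℓ → Shape (exps 0 0 0 0 0 0 0) t₁ t₂ (suc tℓ)
    p∣τℓξℓ     : ∀ eℓ tℓ → Shape (exps 0 0 0 (suc eℓ) 0 0 0) 0 0 (suc tℓ)
    p∣1st      : ∀ eℓ e₄ e₅ e₆ → e₄ + e₅ ≤ 1 → 0 < 3 * eℓ + 2 * e₄ + e₅ → Shape (exps 0 0 0 eℓ e₄ e₅ e₆) 0 0 0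
    p∣2nd      : ∀ e₂ e₆ t₂ → e₂ ≤ 1 → 0 < 2 * t₂ + e₂ → Shape (exps 0 e₂ 0 0 0 0 e₆) 0 t₂ 0
    p∤1st2nd   : ∀ e₁ e₃ e₆ → e₃ ≤ 1 → Shape (exps e₁ 0 e₃ 0 0 0 e₆) 0 0 0
    p∤1st2nd′  : ∀ e₁ t₁ → Shape (exps e₁ 0 0 0 0 0 0) t₁ 0 0

  data AtMostOne : ℕ → ℕ → ℕ → ℕ → Set where
    none   : AtMostOne 0 0 0 0
    first  : AtMostOne 1 0 0 0
    second : AtMostOne 0 1 0 0
    third  : AtMostOne 0 0 1 0
    fourth : AtMostOne 0 0 0 1

  atMostOne : ∀ {a b c d} → a + b + c + d ≤ 1 → AtMostOne a b c d
  atMostOne {0} {0} {0} {0} _ = none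
  atMostOne {0} {0} {0} {1} _ = fourth
  atMostOne {0} {0} {1} {0} _ = third
  atMostOne {0} {1} {0} {0} _ = second
  atMostOne {1} {0} {0} {0} _ = first
  atMostOne {suc (suc _)} (s≤s ())
  atMostOne {1} {suc _} (s≤s ())
  atMostOne {1} {0} {suc _} (s≤s ())
  atMostOne {1} {0} {0} {suc _} (s≤s ())
  atMostOne {0} {suc (suc _)} (s≤s ())
  atMostOne {0} {1} {suc _} (s≤s ())
  atMostOne {0} {1} {0} {suc _} (s≤s ())
  atMostOne {0} {0} {suc (suc _)} (s≤s ())
  atMostOne {0} {0} {1} {suc _} (s≤s ())
  atMostOne {0} {0} {0} {suc (suc _)} (s≤s ())

  0<n⇒0<m+n : ∀ m {n} → 0 < n → 0 < m + n
  0<n⇒0<m+n m {n} 0<n = ≤-trans 0<n (m≤n+m n m)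

  0<m⇒0<m+n : ∀ {m} n → 0 < m → 0 < m + n
  0<m⇒0<m+n {m} n 0<m = ≤-trans 0<m (m≤m+n m n)

  -- Split by the squarefree part, where at most one of e₂, e₃, e₄, e₅ is 1. Each clause either builds
  -- the shape or refutes a coprimality condition (absurd pattern) or the torsor condition T.
  private
    shape-none : ∀ e₁ eℓ e₆ t₁ t₂ tℓ → Coprimality (exps e₁ 0 0 eℓ 0 0 e₆) t₁ t₂ tℓ →
                 TorsorValuations (exps e₁ 0 0 eℓ 0 0 e₆) t₁ t₂ tℓ → Shape (exps e₁ 0 0 eℓ 0 0 e₆) t₁ t₂ tℓ
    shape-none _       _        (suc _) _       _       (suc _)  (_ , () , _) _
    shape-none (suc _) _        _       _       (suc _) _        (() , _) _
    shape-none (suc _) _        _       t₁      0       (suc _)  _ T = ⊥-elim (y-not-min T z<s (0<m⇒0<m+n 0 (0<n⇒0<m+n (3 * t₁) z<s)))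
    shape-none _       (suc _)  _       (suc _) _       _        (_ , _ , _ , _ , ()) _
    shape-none (suc _) (suc _)  _       0       0       0        _ T = ⊥-elim (y-not-min T z<s z<s)
    shape-none 0       0        0       t₁      t₂      (suc tℓ) _ _ = p∣τℓ t₁ t₂ tℓ
    shape-none 0       (suc eℓ) 0       0       0       (suc tℓ) _ _ = p∣τℓξℓ eℓ tℓ
    shape-none 0       (suc _)  0       0       (suc _) (suc _)  _ T = ⊥-elim (z-not-min T z<s z<s)
    shape-none 0       (suc eℓ) e₆      0       0       0        _ _ = p∣1st (suc eℓ) 0 0 e₆ z≤n z<s
    shape-none 0       (suc _)  _       0       (suc _) 0        _ T = ⊥-elim (z-not-min T z<s z<s)
    shape-none _       0        _       (suc _) (suc _) 0        _ T = ⊥-elim (x-not-min T z<s z<s)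
    shape-none 0       0        e₆      0       (suc t₂) 0       _ _ = p∣2nd 0 e₆ (suc t₂) z≤n z<s
    shape-none e₁      0        e₆      0       0       0        _ _ = p∤1st2nd e₁ 0 e₆ z≤n
    shape-none e₁      0        0       (suc t₁) 0      0        _ _ = p∤1st2nd′ e₁ (suc t₁)
    shape-none _       0        (suc _) (suc _) 0       0        (_ , _ , _ , _ , ()) _

    shape-e₂ : ∀ e₁ eℓ e₆ t₁ t₂ tℓ → Coprimality (exps e₁ 1 0 eℓ 0 0 e₆) t₁ t₂ tℓ →
               TorsorValuations (exps e₁ 1 0 eℓ 0 0 e₆) t₁ t₂ tℓ → Shape (exps e₁ 1 0 eℓ 0 0 e₆) t₁ t₂ tℓ
    shape-e₂ (suc _) _       _  _       _  _       (_ , _ , _ , () , _) _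
    shape-e₂ _       _       _  (suc _) _  _       (_ , _ , _ , _ , ()) _
    shape-e₂ 0       _       _  0       t₂ (suc _) _ T = ⊥-elim (z-not-min T z<s (0<n⇒0<m+n (2 * t₂) z<s))
    shape-e₂ 0       (suc _) _  0       t₂ 0       _ T = ⊥-elim (z-not-min T z<s (0<n⇒0<m+n (2 * t₂) z<s))
    shape-e₂ 0       0       e₆ 0       t₂ 0       _ _ = p∣2nd 1 e₆ t₂ ≤-refl (0<n⇒0<m+n (2 * t₂) z<s)

    shape-e₃ : ∀ e₁ eℓ e₆ t₁ t₂ tℓ → Coprimality (exps e₁ 0 1 eℓ 0 0 e₆) t₁ t₂ tℓ →
               TorsorValuations (exps e₁ 0 1 eℓ 0 0 e₆) t₁ t₂ tℓ → Shape (exps e₁ 0 1 eℓ 0 0 e₆) t₁ t₂ tℓ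
    shape-e₃ 0       _       _  _       (suc _) _       (() , _) _
    shape-e₃ (suc _) _       _  _       (suc _) _       (() , _) _
    shape-e₃ _       _       _  (suc _) _       _       (_ , _ , _ , _ , ()) _
    shape-e₃ e₁      _       _  0       0       (suc _) _ T = ⊥-elim (y-not-min T z<s (0<n⇒0<m+n (2 * e₁) z<s))
    shape-e₃ e₁      (suc _) _  0       0       0       _ T = ⊥-elim (y-not-min T z<s (0<n⇒0<m+n (2 * e₁) z<s))
    shape-e₃ e₁      0       e₆ 0       0       0       _ _ = p∤1st2nd e₁ 1 e₆ ≤-refl

    shape-e₄ : ∀ e₁ eℓ e₆ t₁ t₂ tℓ → Coprimality (exps e₁ 0 0 eℓ 1 0 e₆) t₁ t₂ tℓ →
               TorsorValuations (exps e₁ 0 0 eℓ 1 0 e₆) t₁ t₂ tℓ → Shape (exps e₁ 0 0 eℓ 1 0 e₆) t₁ t₂ tℓ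
    shape-e₄ _       _       _  _       _       (suc _) (_ , () , _) _
    shape-e₄ _       0       _  (suc _) _       _       (_ , _ , _ , _ , ()) _
    shape-e₄ _       (suc _) _  (suc _) _       _       (_ , _ , _ , _ , ()) _
    shape-e₄ (suc _) _       _  _       (suc _) _       (() , _) _
    shape-e₄ (suc _) eℓ      _  0       0       0       _ T = ⊥-elim (y-not-min T (0<m⇒0<m+n 0 (0<n⇒0<m+n (3 * eℓ) z<s)) z<s)
    shape-e₄ 0       eℓ      _  0       (suc _) 0       _ T = ⊥-elim (z-not-min T (0<m⇒0<m+n 0 (0<n⇒0<m+n (3 * eℓ) z<s)) z<s)
    shape-e₄ 0       eℓ      e₆ 0       0       0       _ _ = p∣1st eℓ 1 0 e₆ ≤-refl (0<m⇒0<m+n 0 (0<n⇒0<m+n (3 * eℓ) z<s))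

    shape-e₅ : ∀ e₁ eℓ e₆ t₁ t₂ tℓ → Coprimality (exps e₁ 0 0 eℓ 0 1 e₆) t₁ t₂ tℓ →
               TorsorValuations (exps e₁ 0 0 eℓ 0 1 e₆) t₁ t₂ tℓ → Shape (exps e₁ 0 0 eℓ 0 1 e₆) t₁ t₂ tℓ
    shape-e₅ _       _       _  _       _       (suc _) (_ , () , _) _
    shape-e₅ _       0       _  (suc _) _       _       (_ , _ , _ , _ , ()) _
    shape-e₅ _       (suc _) _  (suc _) _       _       (_ , _ , _ , _ , ()) _
    shape-e₅ (suc _) _       _  _       (suc _) _       (() , _) _
    shape-e₅ (suc _) eℓ      _  0       0       0       _ T = ⊥-elim (y-not-min T (0<n⇒0<m+n (3 * eℓ + 0) z<s) z<s)
    shape-e₅ 0       eℓ      _  0       (suc _) 0       _ T = ⊥-elim (z-not-min T (0<n⇒0<m+n (3 * eℓ + 0) z<s) z<s)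
    shape-e₅ 0       eℓ      e₆ 0       0       0       _ _ = p∣1st eℓ 0 1 e₆ ≤-refl (0<n⇒0<m+n (3 * eℓ + 0) z<s)

  shape : ∀ {e t₁ t₂ tℓ} → Coprimality e t₁ t₂ tℓ → TorsorValuations e t₁ t₂ tℓ → Shape e t₁ t₂ tℓ
  shape {exps e₁ e₂ e₃ eℓ e₄ e₅ e₆} {t₁} {t₂} {tℓ} c@(_ , _ , squarefree , _) T
    with atMostOne {e₂} {e₃} {e₄} {e₅} squarefree
  ... | none   = shape-none e₁ eℓ e₆ t₁ t₂ tℓ c T
  ... | first  = shape-e₂ e₁ eℓ e₆ t₁ t₂ tℓ c T
  ... | second = shape-e₃ e₁ eℓ e₆ t₁ t₂ tℓ c T
  ... | third  = shape-e₄ e₁ eℓ e₆ t₁ t₂ tℓ c T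
  ... | fourth = shape-e₅ e₁ eℓ e₆ t₁ t₂ tℓ c T

  shape⇒coprimality : ∀ {e t₁ t₂ tℓ} → Shape e t₁ t₂ tℓ → Coprimality e t₁ t₂ tℓ
  shape⇒coprimality (p∣τℓ t₁ t₂ tℓ)            = ⊓-zeroʳ t₂ , refl , z≤n , refl , ⊓-zeroʳ t₁
  shape⇒coprimality (p∣τℓξℓ eℓ tℓ)             = refl , refl , z≤n , refl , refl
  shape⇒coprimality (p∣1st eℓ e₄ e₅ e₆ e₄+e₅≤1 _) = refl , refl , e₄+e₅≤1 , refl , refl
  shape⇒coprimality (p∣2nd 0 e₆ t₂ _ _)        = ⊓-zeroʳ t₂ , refl , z≤n , refl , refl
  shape⇒coprimality (p∣2nd 1 e₆ t₂ _ _)        = ⊓-zeroʳ t₂ , refl , ≤-refl , refl , refl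
  shape⇒coprimality (p∣2nd (suc (suc _)) _ _ (s≤s ()) _)
  shape⇒coprimality (p∤1st2nd e₁ 0 e₆ _)       = refl , refl , z≤n , ⊓-zeroʳ e₁ , refl
  shape⇒coprimality (p∤1st2nd e₁ 1 e₆ _)       = refl , refl , ≤-refl , ⊓-zeroʳ e₁ , refl
  shape⇒coprimality (p∤1st2nd _ (suc (suc _)) _ (s≤s ()))
  shape⇒coprimality (p∤1st2nd′ e₁ t₁)          = refl , refl , z≤n , ⊓-zeroʳ e₁ , ⊓-zeroʳ t₁

  m⊓0⊓n⊓o≡0 : ∀ m n o → m ⊓ 0 ⊓ n ⊓ o ≡ 0
  m⊓0⊓n⊓o≡0 m n o = cong (λ k → k ⊓ n ⊓ o) (⊓-zeroʳ m)

  shape⇒image-coprime : ∀ {e t₁ t₂ tℓ} → Shape e t₁ t₂ tℓ → (exp₀ e + t₂) ⊓ tℓ ⊓ exp₂ e ⊓ (exp₃ e + t₁) ≡ 0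
  shape⇒image-coprime (p∣τℓ t₁ t₂ tℓ) = cong (_⊓ t₁) (⊓-zeroʳ (t₂ ⊓ suc tℓ))
  shape⇒image-coprime (p∣τℓξℓ eℓ tℓ)  = refl
  shape⇒image-coprime (p∣1st _ _ _ _ _ _)  = m⊓0⊓n⊓o≡0 _ _ _
  shape⇒image-coprime (p∣2nd _ _ _ _ _)    = m⊓0⊓n⊓o≡0 _ _ _
  shape⇒image-coprime (p∤1st2nd _ _ _ _)   = m⊓0⊓n⊓o≡0 _ _ _
  shape⇒image-coprime (p∤1st2nd′ _ _)      = m⊓0⊓n⊓o≡0 _ _ _

  divmod-unique : ∀ d q r .{{_ : NonZero d}} → r < d → (r + d * q) / d ≡ q × (r + d * q) % d ≡ r
  divmod-unique d q r r<d = quotient≡ , remainder≡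
    where
    r+qd≡ : r + d * q ≡ r + q * d
    r+qd≡ = cong (r +_) (*-comm d q)
    remainder≡ : (r + d * q) % d ≡ r
    remainder≡ = trans (cong (_% d) r+qd≡) (trans ([m+kn]%n≡m%n r q d) (m<n⇒m%n≡m r<d))
    remainders<d : r % d + q * d % d < d
    remainders<d = subst₂ (λ a b → a + b < d) (sym (m<n⇒m%n≡m r<d)) (sym (m*n%n≡0 q d)) (subst (_< d) (sym (+-identityʳ r)) r<d)
    quotient≡ : (r + d * q) / d ≡ q
    quotient≡ = begin
      (r + d * q) / d     ≡⟨ cong (_/ d) r+qd≡ ⟩
      (r + q * d) / d     ≡⟨ +-distrib-/ r (q * d) remainders<d ⟩
      r / d + q * d / d   ≡⟨ cong₂ _+_ (m<n⇒m/n≡0 r<d) (m*n/n≡m q d) ⟩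
      q                   ∎
      where open ≡-Reasoning

  recoverα : ℕ → ℕ → Exponents
  recoverα A C = exps 0 0 0 (C ∸ (2 * e₄ + 3 * e₅ + 4 * e₆)) e₄ e₅ e₆
    where
    e₆ = A / 3
    e₄ = A % 3 % 2
    e₅ = A % 3 / 2

  recoverβ : ℕ → Exponents
  recoverβ U = exps 0 (U / 3 % 2) 0 0 0 0 (U / 3 / 2)

  recoverγ : ℕ → ℕ → Exponents
  recoverγ A C = exps (A ∸ (2 * e₃ + 3 * e₆)) 0 e₃ 0 0 0 e₆
    where
    e₃ = (2 * A ∸ C) % 2
    e₆ = (2 * A ∸ C) / 2

  -- Reads e off (A, B, U, C) on the image of each shape: B > 0 only allows ξℓ, and otherwise
  -- comparing 2A with U decides between the shapes p∣1st, p∤1st2nd and p∣2nd.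
  recover : ℕ → ℕ → ℕ → ℕ → Exponents
  recover A (suc _) U C = exps 0 0 0 (U / 3) 0 0 0
  recover A zero U C with <-cmp (2 * A) U
  ... | tri< _ _ _ = recoverα A C
  ... | tri≈ _ _ _ = recoverγ A C
  ... | tri> _ _ _ = recoverβ U

  recover-α : ∀ {A U} C → 2 * A < U → recover A 0 U C ≡ recoverα A C
  recover-α {A} {U} C 2A<U with <-cmp (2 * A) U
  ... | tri< _ _ _ = refl
  ... | tri≈ ¬< _ _ = ⊥-elim (¬< 2A<U)
  ... | tri> ¬< _ _ = ⊥-elim (¬< 2A<U)

  recover-β : ∀ {A U} C → U < 2 * A → recover A 0 U C ≡ recoverβ U
  recover-β {A} {U} C U<2A with <-cmp (2 * A) U
  ... | tri< _ _ ¬> = ⊥-elim (¬> U<2A)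
  ... | tri≈ _ _ ¬> = ⊥-elim (¬> U<2A)
  ... | tri> _ _ _ = refl

  recover-γ : ∀ {A U} C → 2 * A ≡ U → recover A 0 U C ≡ recoverγ A C
  recover-γ {A} {U} C 2A≡U with <-cmp (2 * A) U
  ... | tri< _ ¬≡ _ = ⊥-elim (¬≡ 2A≡U)
  ... | tri≈ _ _ _ = refl
  ... | tri> _ ¬≡ _ = ⊥-elim (¬≡ 2A≡U)

  e₄+e₅≤1⇒e₄+2e₅<3 : ∀ {e₄ e₅} → e₄ + e₅ ≤ 1 → e₄ + 2 * e₅ < 3
  e₄+e₅≤1⇒e₄+2e₅<3 {0} {0} _ = s≤s z≤n
  e₄+e₅≤1⇒e₄+2e₅<3 {1} {0} _ = s≤s (s≤s z≤n)
  e₄+e₅≤1⇒e₄+2e₅<3 {0} {1} _ = s≤s (s≤s (s≤s z≤n))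
  e₄+e₅≤1⇒e₄+2e₅<3 {suc (suc _)} (s≤s ())
  e₄+e₅≤1⇒e₄+2e₅<3 {1} {suc _} (s≤s ())
  e₄+e₅≤1⇒e₄+2e₅<3 {0} {suc (suc _)} (s≤s ())

  exps-cong : ∀ {a₁ a₂ a₃ aℓ a₄ a₅ a₆ b₁ b₂ b₃ bℓ b₄ b₅ b₆} →
              a₁ ≡ b₁ → a₂ ≡ b₂ → a₃ ≡ b₃ → aℓ ≡ bℓ → a₄ ≡ b₄ → a₅ ≡ b₅ → a₆ ≡ b₆ →
              exps a₁ a₂ a₃ aℓ a₄ a₅ a₆ ≡ exps b₁ b₂ b₃ bℓ b₄ b₅ b₆
  exps-cong refl refl refl refl refl refl refl = refl

  recoverα-exps : ∀ eℓ e₄ e₅ e₆ → e₄ + e₅ ≤ 1 →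
                  recoverα (e₄ + 2 * e₅ + 3 * e₆) (eℓ + 2 * e₄ + 3 * e₅ + 4 * e₆) ≡ exps 0 0 0 eℓ e₄ e₅ e₆
  recoverα-exps eℓ e₄ e₅ e₆ e₄+e₅≤1 = exps-cong refl refl refl eℓ≡ e₄≡ e₅≡ e₆≡
    where
    A = e₄ + 2 * e₅ + 3 * e₆
    C = eℓ + 2 * e₄ + 3 * e₅ + 4 * e₆
    A%3≡ = proj₂ (divmod-unique 3 e₆ (e₄ + 2 * e₅) (e₄+e₅≤1⇒e₄+2e₅<3 {e₄} {e₅} e₄+e₅≤1))
    e₆≡ = proj₁ (divmod-unique 3 e₆ (e₄ + 2 * e₅) (e₄+e₅≤1⇒e₄+2e₅<3 {e₄} {e₅} e₄+e₅≤1))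
    e₄≡ : A % 3 % 2 ≡ e₄
    e₄≡ = trans (cong (_% 2) A%3≡) (proj₂ (divmod-unique 2 e₅ e₄ (s≤s (≤-trans (m≤m+n e₄ e₅) e₄+e₅≤1))))
    e₅≡ : A % 3 / 2 ≡ e₅
    e₅≡ = trans (cong (_/ 2) A%3≡) (proj₁ (divmod-unique 2 e₅ e₄ (s≤s (≤-trans (m≤m+n e₄ e₅) e₄+e₅≤1))))
    C≡ : ∀ eℓ e₄ e₅ e₆ → eℓ + 2 * e₄ + 3 * e₅ + 4 * e₆ ≡ eℓ + (2 * e₄ + 3 * e₅ + 4 * e₆)
    C≡ = solve-∀
    eℓ≡ : C ∸ (2 * (A % 3 % 2) + 3 * (A % 3 / 2) + 4 * (A / 3)) ≡ eℓ
    eℓ≡ = begin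
      C ∸ (2 * (A % 3 % 2) + 3 * (A % 3 / 2) + 4 * (A / 3)) ≡⟨ cong (C ∸_) (cong₂ _+_ (cong₂ _+_ (cong (2 *_) e₄≡) (cong (3 *_) e₅≡)) (cong (4 *_) e₆≡)) ⟩
      C ∸ (2 * e₄ + 3 * e₅ + 4 * e₆)                       ≡⟨ cong (_∸ (2 * e₄ + 3 * e₅ + 4 * e₆)) (C≡ eℓ e₄ e₅ e₆) ⟩
      eℓ + (2 * e₄ + 3 * e₅ + 4 * e₆) ∸ (2 * e₄ + 3 * e₅ + 4 * e₆) ≡⟨ m+n∸n≡m eℓ (2 * e₄ + 3 * e₅ + 4 * e₆) ⟩
      eℓ                                                   ∎
      where open ≡-Reasoning

  recoverβ-exps : ∀ e₂ e₆ → e₂ ≤ 1 → recoverβ (3 * (e₂ + 2 * e₆)) ≡ exps 0 e₂ 0 0 0 0 e₆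
  recoverβ-exps e₂ e₆ e₂≤1 = exps-cong refl e₂≡ refl refl refl refl e₆≡
    where
    U/3≡ = proj₁ (divmod-unique 3 (e₂ + 2 * e₆) 0 z<s)
    e₂≡ : 3 * (e₂ + 2 * e₆) / 3 % 2 ≡ e₂
    e₂≡ = trans (cong (_% 2) U/3≡) (proj₂ (divmod-unique 2 e₆ e₂ (s≤s e₂≤1)))
    e₆≡ : 3 * (e₂ + 2 * e₆) / 3 / 2 ≡ e₆
    e₆≡ = trans (cong (_/ 2) U/3≡) (proj₁ (divmod-unique 2 e₆ e₂ (s≤s e₂≤1)))

  recoverγ-exps : ∀ e₁ e₃ e₆ → e₃ ≤ 1 →
                  recoverγ (e₁ + 2 * e₃ + 3 * e₆) (2 * e₁ + 3 * e₃ + 4 * e₆) ≡ exps e₁ 0 e₃ 0 0 0 e₆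
  recoverγ-exps e₁ e₃ e₆ e₃≤1 = exps-cong e₁≡ refl e₃≡ refl refl refl e₆≡
    where
    A = e₁ + 2 * e₃ + 3 * e₆
    C = 2 * e₁ + 3 * e₃ + 4 * e₆
    2A≡C+d : ∀ e₁ e₃ e₆ → 2 * (e₁ + 2 * e₃ + 3 * e₆) ≡ (2 * e₁ + 3 * e₃ + 4 * e₆) + (e₃ + 2 * e₆)
    2A≡C+d = solve-∀
    A≡ : ∀ e₁ e₃ e₆ → e₁ + 2 * e₃ + 3 * e₆ ≡ e₁ + (2 * e₃ + 3 * e₆)
    A≡ = solve-∀
    d≡ : 2 * A ∸ C ≡ e₃ + 2 * e₆
    d≡ = trans (cong (_∸ C) (2A≡C+d e₁ e₃ e₆)) (m+n∸m≡n C (e₃ + 2 * e₆))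
    e₃≡ : (2 * A ∸ C) % 2 ≡ e₃
    e₃≡ = trans (cong (_% 2) d≡) (proj₂ (divmod-unique 2 e₆ e₃ (s≤s e₃≤1)))
    e₆≡ : (2 * A ∸ C) / 2 ≡ e₆
    e₆≡ = trans (cong (_/ 2) d≡) (proj₁ (divmod-unique 2 e₆ e₃ (s≤s e₃≤1)))
    e₁≡ : A ∸ (2 * ((2 * A ∸ C) % 2) + 3 * ((2 * A ∸ C) / 2)) ≡ e₁
    e₁≡ = begin
      A ∸ (2 * ((2 * A ∸ C) % 2) + 3 * ((2 * A ∸ C) / 2)) ≡⟨ cong (λ x → A ∸ x) (cong₂ _+_ (cong (2 *_) e₃≡) (cong (3 *_) e₆≡)) ⟩
      A ∸ (2 * e₃ + 3 * e₆)                               ≡⟨ cong (_∸ (2 * e₃ + 3 * e₆)) (A≡ e₁ e₃ e₆) ⟩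
      e₁ + (2 * e₃ + 3 * e₆) ∸ (2 * e₃ + 3 * e₆)          ≡⟨ m+n∸n≡m e₁ (2 * e₃ + 3 * e₆) ⟩
      e₁                                                  ∎
      where open ≡-Reasoning

  recoverγ-exps′ : ∀ e₁ t₁ → recoverγ e₁ (2 * e₁ + t₁) ≡ exps e₁ 0 0 0 0 0 0
  recoverγ-exps′ e₁ t₁ = cong (λ d → exps (e₁ ∸ (2 * (d % 2) + 3 * (d / 2))) 0 (d % 2) 0 0 0 (d / 2))
                              (m≤n⇒m∸n≡0 (m≤m+n (2 * e₁) t₁))

  recover-shape : ∀ {e t₁ t₂ tℓ} → Shape e t₁ t₂ tℓ → recover (exp₀ e + t₂) tℓ (exp₂ e) (exp₃ e + t₁) ≡ e
  recover-shape (p∣τℓ t₁ t₂ tℓ) = refl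
  recover-shape (p∣τℓξℓ eℓ tℓ) =
    cong (λ eℓ′ → exps 0 0 0 eℓ′ 0 0 0) (trans (cong (_/ 3) (U≡ (suc eℓ))) (proj₁ (divmod-unique 3 (suc eℓ) 0 z<s)))
    where
    U≡ : ∀ eℓ → 3 * eℓ + 4 * 0 + 5 * 0 + 6 * 0 ≡ 3 * eℓ
    U≡ = solve-∀
  recover-shape (p∣1st eℓ e₄ e₅ e₆ e₄+e₅≤1 w>0) = begin
    recover (A + 0) 0 U (C + 0)        ≡⟨ recover-α (C + 0) (subst (2 * (A + 0) <_) (sym (U≡ eℓ e₄ e₅ e₆)) (m<m+n _ w>0)) ⟩
    recoverα (A + 0) (C + 0)           ≡⟨ cong₂ recoverα (+-identityʳ A) (+-identityʳ C) ⟩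
    recoverα A C                       ≡⟨ recoverα-exps eℓ e₄ e₅ e₆ e₄+e₅≤1 ⟩
    exps 0 0 0 eℓ e₄ e₅ e₆             ∎
    where
    open ≡-Reasoning
    A = e₄ + 2 * e₅ + 3 * e₆
    U = 3 * eℓ + 4 * e₄ + 5 * e₅ + 6 * e₆
    C = eℓ + 2 * e₄ + 3 * e₅ + 4 * e₆
    U≡ : ∀ eℓ e₄ e₅ e₆ → 3 * eℓ + 4 * e₄ + 5 * e₅ + 6 * e₆ ≡ 2 * (e₄ + 2 * e₅ + 3 * e₆ + 0) + (3 * eℓ + 2 * e₄ + e₅)
    U≡ = solve-∀
  recover-shape (p∣2nd e₂ e₆ t₂ e₂≤1 w>0) = begin
    recover A 0 U C                    ≡⟨ recover-β C (subst (U <_) (sym (2A≡U+w e₂ e₆ t₂)) (m<m+n U w>0)) ⟩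
    recoverβ U                         ≡⟨ cong recoverβ (U≡ e₂ e₆) ⟩
    recoverβ (3 * (e₂ + 2 * e₆))       ≡⟨ recoverβ-exps e₂ e₆ e₂≤1 ⟩
    exps 0 e₂ 0 0 0 0 e₆               ∎
    where
    open ≡-Reasoning
    A = 2 * e₂ + 0 + 0 + 0 + 3 * e₆ + t₂
    U = 3 * e₂ + 0 + 0 + 0 + 0 + 6 * e₆
    C = 2 * e₂ + 0 + 0 + 0 + 0 + 4 * e₆ + 0
    2A≡U+w : ∀ e₂ e₆ t₂ → 2 * (2 * e₂ + 0 + 0 + 0 + 3 * e₆ + t₂) ≡ 3 * e₂ + 0 + 0 + 0 + 0 + 6 * e₆ + (2 * t₂ + e₂)
    2A≡U+w = solve-∀
    U≡ : ∀ e₂ e₆ → 3 * e₂ + 0 + 0 + 0 + 0 + 6 * e₆ ≡ 3 * (e₂ + 2 * e₆)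
    U≡ = solve-∀
  recover-shape (p∤1st2nd e₁ e₃ e₆ e₃≤1) = begin
    recover (A + 0) 0 U (C + 0)        ≡⟨ recover-γ (C + 0) (2A≡U e₁ e₃ e₆) ⟩
    recoverγ (A + 0) (C + 0)           ≡⟨ cong₂ recoverγ (A≡ e₁ e₃ e₆) (C≡ e₁ e₃ e₆) ⟩
    recoverγ (e₁ + 2 * e₃ + 3 * e₆) (2 * e₁ + 3 * e₃ + 4 * e₆) ≡⟨ recoverγ-exps e₁ e₃ e₆ e₃≤1 ⟩
    exps e₁ 0 e₃ 0 0 0 e₆              ∎
    where
    open ≡-Reasoning
    A = e₁ + 0 + 2 * e₃ + 0 + 0 + 3 * e₆
    U = 2 * e₁ + 0 + 4 * e₃ + 0 + 0 + 0 + 6 * e₆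
    C = 2 * e₁ + 0 + 3 * e₃ + 0 + 0 + 0 + 4 * e₆
    2A≡U : ∀ e₁ e₃ e₆ → 2 * (e₁ + 0 + 2 * e₃ + 0 + 0 + 3 * e₆ + 0) ≡ 2 * e₁ + 0 + 4 * e₃ + 0 + 0 + 0 + 6 * e₆
    2A≡U = solve-∀
    A≡ : ∀ e₁ e₃ e₆ → e₁ + 0 + 2 * e₃ + 0 + 0 + 3 * e₆ + 0 ≡ e₁ + 2 * e₃ + 3 * e₆
    A≡ = solve-∀
    C≡ : ∀ e₁ e₃ e₆ → 2 * e₁ + 0 + 3 * e₃ + 0 + 0 + 0 + 4 * e₆ + 0 ≡ 2 * e₁ + 3 * e₃ + 4 * e₆
    C≡ = solve-∀
  recover-shape (p∤1st2nd′ e₁ t₁) = begin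
    recover (A + 0) 0 U (C + t₁)       ≡⟨ recover-γ (C + t₁) (2A≡U e₁) ⟩
    recoverγ (A + 0) (C + t₁)          ≡⟨ cong₂ recoverγ (A≡ e₁) (cong (_+ t₁) (C≡ e₁)) ⟩
    recoverγ e₁ (2 * e₁ + t₁)          ≡⟨ recoverγ-exps′ e₁ t₁ ⟩
    exps e₁ 0 0 0 0 0 0                ∎
    where
    open ≡-Reasoning
    A = e₁ + 0 + 0 + 0 + 0 + 0
    U = 2 * e₁ + 0 + 0 + 0 + 0 + 0 + 0
    C = 2 * e₁ + 0 + 0 + 0 + 0 + 0 + 0
    2A≡U : ∀ e₁ → 2 * (e₁ + 0 + 0 + 0 + 0 + 0 + 0) ≡ 2 * e₁ + 0 + 0 + 0 + 0 + 0 + 0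
    2A≡U = solve-∀
    A≡ : ∀ e₁ → e₁ + 0 + 0 + 0 + 0 + 0 + 0 ≡ e₁
    A≡ = solve-∀
    C≡ : ∀ e₁ → 2 * e₁ + 0 + 0 + 0 + 0 + 0 + 0 ≡ 2 * e₁
    C≡ = solve-∀

  ternary-digit : ∀ {r} → r < 3 → ∃₂ λ e₄ e₅ → e₄ + e₅ ≤ 1 × e₄ + 2 * e₅ ≡ r
  ternary-digit {0} _ = 0 , 0 , z≤n , refl
  ternary-digit {1} _ = 1 , 0 , ≤-refl , refl
  ternary-digit {2} _ = 0 , 1 , ≤-refl , refl
  ternary-digit {suc (suc (suc _))} (s≤s (s≤s (s≤s ())))

  -- Both bounds use that a multiple of 3 (resp. 2) exceeding the left-hand side exceeds it by a whole step.
  ℓ-bound : ∀ e₄ e₅ q C → e₄ + e₅ ≤ 1 → 4 * e₄ + 8 * e₅ + 3 * (4 * q) < 3 * C → 2 * e₄ + 3 * e₅ + 4 * q ≤ C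
  ℓ-bound 0 0 q C _ h = <⇒≤ (*-cancelˡ-< 3 (4 * q) C h)
  ℓ-bound 1 0 q C _ h = *-cancelˡ-< 3 (1 + 4 * q) C (<-trans (subst (3 * (1 + 4 * q) <_) (step q) (m<m+n _ z<s)) h)
    where
    step : ∀ q → 3 * (1 + 4 * q) + 1 ≡ 4 + 3 * (4 * q)
    step = solve-∀
  ℓ-bound 0 1 q C _ h = *-cancelˡ-< 3 (2 + 4 * q) C (<-trans (subst (3 * (2 + 4 * q) <_) (step q) (m<m+n _ z<s)) h)
    where
    step : ∀ q → 3 * (2 + 4 * q) + 2 ≡ 8 + 3 * (4 * q)
    step = solve-∀
  ℓ-bound (suc (suc _)) _ _ _ (s≤s ()) _
  ℓ-bound 1 (suc _) _ _ (s≤s ()) _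
  ℓ-bound 0 (suc (suc _)) _ _ (s≤s ()) _

  half-bound : ∀ e f A → e ≤ 1 → 3 * e + 2 * (3 * f) ≤ 2 * A → 2 * e + 3 * f ≤ A
  half-bound 0 f A _ h = *-cancelˡ-≤ 2 h
  half-bound 1 f A _ h = *-cancelˡ-< 2 (1 + 3 * f) A (<-≤-trans (subst (2 * (1 + 3 * f) <_) (step f) (m<m+n _ z<s)) h)
    where
    step : ∀ f → 2 * (1 + 3 * f) + 1 ≡ 3 + 2 * (3 * f)
    step = solve-∀
  half-bound (suc (suc _)) _ _ (s≤s ()) _

  record Preimage (A B U C : ℕ) : Set where
    constructor preimage
    field
      {e}      : Exponents
      {t₁ t₂}  : ℕ
      shape-of : Shape e t₁ t₂ B
      A≡       : exp₀ e + t₂ ≡ A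
      U≡       : exp₂ e ≡ U
      C≡       : exp₃ e + t₁ ≡ C

  α-preimage : ∀ {A U C} → 2 * A < U → 3 * C ≡ U + 2 * A → Preimage A 0 U C
  α-preimage {A} {U} {C} 2A<U 3C≡U+2A with ternary-digit (m%n<n A 3)
  ... | e₄ , e₅ , e₄+e₅≤1 , r≡ = preimage (p∣1st eℓ e₄ e₅ q e₄+e₅≤1 w>0) A≡ U≡ C≡
    where
    q = A / 3
    A≡′ : e₄ + 2 * e₅ + 3 * q ≡ A
    A≡′ = sym (trans (m≡m%n+[m/n]*n A 3) (cong₂ _+_ (sym r≡) (*-comm q 3)))
    3C>4A : 4 * e₄ + 8 * e₅ + 3 * (4 * q) < 3 * C
    3C>4A = subst₂ _<_ (trans (cong (λ a → 2 * a + 2 * a) (sym A≡′)) (four-A e₄ e₅ q)) (sym 3C≡U+2A) (+-monoˡ-< (2 * A) 2A<U)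
      where
      four-A : ∀ e₄ e₅ q → 2 * (e₄ + 2 * e₅ + 3 * q) + 2 * (e₄ + 2 * e₅ + 3 * q) ≡ 4 * e₄ + 8 * e₅ + 3 * (4 * q)
      four-A = solve-∀
    eℓ = C ∸ (2 * e₄ + 3 * e₅ + 4 * q)
    C≡′ : eℓ + 2 * e₄ + 3 * e₅ + 4 * q ≡ C
    C≡′ = trans (regroup eℓ e₄ e₅ q) (m∸n+n≡m (ℓ-bound e₄ e₅ q C e₄+e₅≤1 3C>4A))
      where
      regroup : ∀ eℓ e₄ e₅ q → eℓ + 2 * e₄ + 3 * e₅ + 4 * q ≡ eℓ + (2 * e₄ + 3 * e₅ + 4 * q)
      regroup = solve-∀
    U≡ : 3 * eℓ + 4 * e₄ + 5 * e₅ + 6 * q ≡ U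
    U≡ = +-cancelʳ-≡ (2 * A) _ U (begin
      3 * eℓ + 4 * e₄ + 5 * e₅ + 6 * q + 2 * A                         ≡⟨ cong (λ a → 3 * eℓ + 4 * e₄ + 5 * e₅ + 6 * q + 2 * a) A≡′ ⟨
      3 * eℓ + 4 * e₄ + 5 * e₅ + 6 * q + 2 * (e₄ + 2 * e₅ + 3 * q)     ≡⟨ expand eℓ e₄ e₅ q ⟩
      3 * (eℓ + 2 * e₄ + 3 * e₅ + 4 * q)                               ≡⟨ cong (3 *_) C≡′ ⟩
      3 * C                                                            ≡⟨ 3C≡U+2A ⟩
      U + 2 * A                                                        ∎)
      where
      open ≡-Reasoning
      expand : ∀ eℓ e₄ e₅ q → 3 * eℓ + 4 * e₄ + 5 * e₅ + 6 * q + 2 * (e₄ + 2 * e₅ + 3 * q) ≡ 3 * (eℓ + 2 * e₄ + 3 * e₅ + 4 * q)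
      expand = solve-∀
    w>0 : 0 < 3 * eℓ + 2 * e₄ + e₅
    w>0 = +-cancelˡ-< (2 * A) 0 _ (subst₂ _<_ (sym (+-identityʳ (2 * A))) U≡2A+w 2A<U)
      where
      split : ∀ eℓ e₄ e₅ q → 3 * eℓ + 4 * e₄ + 5 * e₅ + 6 * q ≡ 2 * (e₄ + 2 * e₅ + 3 * q) + (3 * eℓ + 2 * e₄ + e₅)
      split = solve-∀
      U≡2A+w : U ≡ 2 * A + (3 * eℓ + 2 * e₄ + e₅)
      U≡2A+w = trans (sym U≡) (trans (split eℓ e₄ e₅ q) (cong (λ a → 2 * a + (3 * eℓ + 2 * e₄ + e₅)) A≡′))
    A≡ : e₄ + 2 * e₅ + 3 * q + 0 ≡ A
    A≡ = trans (+-identityʳ _) A≡′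
    C≡ : eℓ + 2 * e₄ + 3 * e₅ + 4 * q + 0 ≡ C
    C≡ = trans (+-identityʳ _) C≡′

  β-preimage : ∀ {A U C} → U < 2 * A → 3 * C ≡ 2 * U → Preimage A 0 U C
  β-preimage {A} {U} {C} U<2A 3C≡2U = preimage (p∣2nd e₂ e₆ t₂ e₂≤1 w>0) A≡ U≡ C≡
    where
    3∣U = ∣m+n∣m⇒∣n (divides U (trans (three-U U) (*-comm 3 U))) (divides C (trans (sym 3C≡2U) (*-comm 3 C)))
      where
      three-U : ∀ U → 2 * U + U ≡ 3 * U
      three-U = solve-∀
    m = quotient 3∣U
    U≡3m : U ≡ 3 * m
    U≡3m = trans (m∣n⇒n≡quotient*m 3∣U) (*-comm m 3)
    C≡2m : C ≡ 2 * m
    C≡2m = *-cancelˡ-≡ C (2 * m) 3 (trans 3C≡2U (trans (cong (2 *_) U≡3m) (swap m)))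
      where
      swap : ∀ m → 2 * (3 * m) ≡ 3 * (2 * m)
      swap = solve-∀
    e₂ = m % 2
    e₆ = m / 2
    e₂≤1 : e₂ ≤ 1
    e₂≤1 = ≤-pred (m%n<n m 2)
    m≡ : e₂ + 2 * e₆ ≡ m
    m≡ = sym (trans (m≡m%n+[m/n]*n m 2) (cong (e₂ +_) (*-comm e₆ 2)))
    U≡′ : 3 * e₂ + 2 * (3 * e₆) ≡ U
    U≡′ = trans (distrib e₂ e₆) (trans (cong (3 *_) m≡) (sym U≡3m))
      where
      distrib : ∀ e₂ e₆ → 3 * e₂ + 2 * (3 * e₆) ≡ 3 * (e₂ + 2 * e₆)
      distrib = solve-∀
    t₂ = A ∸ (2 * e₂ + 3 * e₆)
    A≡′ : 2 * e₂ + 3 * e₆ + t₂ ≡ A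
    A≡′ = m+[n∸m]≡n (half-bound e₂ e₆ A e₂≤1 (<⇒≤ (subst (_< 2 * A) (sym U≡′) U<2A)))
    w>0 : 0 < 2 * t₂ + e₂
    w>0 = +-cancelˡ-< U 0 _ (subst₂ _<_ (sym (+-identityʳ U)) 2A≡U+w U<2A)
      where
      split : ∀ e₂ e₆ t₂ → 2 * (2 * e₂ + 3 * e₆ + t₂) ≡ 3 * e₂ + 2 * (3 * e₆) + (2 * t₂ + e₂)
      split = solve-∀
      2A≡U+w : 2 * A ≡ U + (2 * t₂ + e₂)
      2A≡U+w = trans (cong (2 *_) (sym A≡′)) (trans (split e₂ e₆ t₂) (cong (_+ (2 * t₂ + e₂)) U≡′))
    A≡ : 2 * e₂ + 0 + 0 + 0 + 3 * e₆ + t₂ ≡ A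
    A≡ = trans (cong (_+ t₂) (drop-zeros e₂ e₆)) A≡′
      where
      drop-zeros : ∀ e₂ e₆ → 2 * e₂ + 0 + 0 + 0 + 3 * e₆ ≡ 2 * e₂ + 3 * e₆
      drop-zeros = solve-∀
    U≡ : 3 * e₂ + 0 + 0 + 0 + 0 + 6 * e₆ ≡ U
    U≡ = trans (regroup e₂ e₆) U≡′
      where
      regroup : ∀ e₂ e₆ → 3 * e₂ + 0 + 0 + 0 + 0 + 6 * e₆ ≡ 3 * e₂ + 2 * (3 * e₆)
      regroup = solve-∀
    C≡ : 2 * e₂ + 0 + 0 + 0 + 0 + 4 * e₆ + 0 ≡ C
    C≡ = trans (regroup e₂ e₆) (trans (cong (2 *_) m≡) (sym C≡2m))
      where
      regroup : ∀ e₂ e₆ → 2 * e₂ + 0 + 0 + 0 + 0 + 4 * e₆ + 0 ≡ 2 * (e₂ + 2 * e₆)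
      regroup = solve-∀

  3[2A∸C]≤2A : ∀ {A C} → C ≤ 2 * A → 4 * A ≤ 3 * C → 3 * (2 * A ∸ C) ≤ 2 * A
  3[2A∸C]≤2A {A} {C} C≤2A 4A≤3C = +-cancelʳ-≤ (4 * A) _ _ (begin
    3 * (2 * A ∸ C) + 4 * A        ≤⟨ +-monoʳ-≤ (3 * (2 * A ∸ C)) 4A≤3C ⟩
    3 * (2 * A ∸ C) + 3 * C        ≡⟨ *-distribˡ-+ 3 (2 * A ∸ C) C ⟨
    3 * (2 * A ∸ C + C)            ≡⟨ cong (3 *_) (m∸n+n≡m C≤2A) ⟩
    3 * (2 * A)                    ≡⟨ six-A A ⟩
    2 * A + 4 * A                  ∎)
    where
    open ≤-Reasoning
    six-A : ∀ A → 3 * (2 * A) ≡ 2 * A + 4 * A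
    six-A = solve-∀

  γ-preimage : ∀ {A U C} → 2 * A ≡ U → 4 * A ≤ 3 * C → Preimage A 0 U C
  γ-preimage {A} {U} {C} 2A≡U 4A≤3C with 2 * A ≤? C
  ... | yes 2A≤C = preimage (p∤1st2nd′ A (C ∸ 2 * A)) (drop-zerosᴬ A) (trans (drop-zerosᵁ A) 2A≡U)
                            (trans (cong (_+ (C ∸ 2 * A)) (drop-zerosᵁ A)) (m+[n∸m]≡n 2A≤C))
    where
    drop-zerosᴬ : ∀ A → A + 0 + 0 + 0 + 0 + 0 + 0 ≡ A
    drop-zerosᴬ = solve-∀
    drop-zerosᵁ : ∀ A → 2 * A + 0 + 0 + 0 + 0 + 0 + 0 ≡ 2 * A
    drop-zerosᵁ = solve-∀
  ... | no 2A≰C = preimage (p∤1st2nd e₁ e₃ e₆ e₃≤1) A≡ U≡ C≡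
    where
    C≤2A = <⇒≤ (≰⇒> 2A≰C)
    d = 2 * A ∸ C
    e₃ = d % 2
    e₆ = d / 2
    e₃≤1 : e₃ ≤ 1
    e₃≤1 = ≤-pred (m%n<n d 2)
    d≡ : e₃ + 2 * e₆ ≡ d
    d≡ = sym (trans (m≡m%n+[m/n]*n d 2) (cong (e₃ +_) (*-comm e₆ 2)))
    e₁ = A ∸ (2 * e₃ + 3 * e₆)
    A≡′ : e₁ + (2 * e₃ + 3 * e₆) ≡ A
    A≡′ = m∸n+n≡m (half-bound e₃ e₆ A e₃≤1 (subst (_≤ 2 * A) (trans (cong (3 *_) (sym d≡)) (distrib e₃ e₆)) (3[2A∸C]≤2A {A} {C} C≤2A 4A≤3C)))
      where
      distrib : ∀ e₃ e₆ → 3 * (e₃ + 2 * e₆) ≡ 3 * e₃ + 2 * (3 * e₆)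
      distrib = solve-∀
    A≡ : e₁ + 0 + 2 * e₃ + 0 + 0 + 3 * e₆ + 0 ≡ A
    A≡ = trans (regroup e₁ e₃ e₆) A≡′
      where
      regroup : ∀ e₁ e₃ e₆ → e₁ + 0 + 2 * e₃ + 0 + 0 + 3 * e₆ + 0 ≡ e₁ + (2 * e₃ + 3 * e₆)
      regroup = solve-∀
    U≡ : 2 * e₁ + 0 + 4 * e₃ + 0 + 0 + 0 + 6 * e₆ ≡ U
    U≡ = trans (regroup e₁ e₃ e₆) (trans (cong (2 *_) A≡′) 2A≡U)
      where
      regroup : ∀ e₁ e₃ e₆ → 2 * e₁ + 0 + 4 * e₃ + 0 + 0 + 0 + 6 * e₆ ≡ 2 * (e₁ + (2 * e₃ + 3 * e₆))
      regroup = solve-∀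
    C≡ : 2 * e₁ + 0 + 3 * e₃ + 0 + 0 + 0 + 4 * e₆ + 0 ≡ C
    C≡ = +-cancelʳ-≡ d _ C (begin
      2 * e₁ + 0 + 3 * e₃ + 0 + 0 + 0 + 4 * e₆ + 0 + d            ≡⟨ cong (2 * e₁ + 0 + 3 * e₃ + 0 + 0 + 0 + 4 * e₆ + 0 +_) d≡ ⟨
      2 * e₁ + 0 + 3 * e₃ + 0 + 0 + 0 + 4 * e₆ + 0 + (e₃ + 2 * e₆) ≡⟨ regroup e₁ e₃ e₆ ⟩
      2 * (e₁ + (2 * e₃ + 3 * e₆))                                 ≡⟨ cong (2 *_) A≡′ ⟩
      2 * A                                                        ≡⟨ m+[n∸m]≡n C≤2A ⟨
      C + d                                                        ∎)
      where
      open ≡-Reasoning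
      regroup : ∀ e₁ e₃ e₆ → 2 * e₁ + 0 + 3 * e₃ + 0 + 0 + 0 + 4 * e₆ + 0 + (e₃ + 2 * e₆) ≡ 2 * (e₁ + (2 * e₃ + 3 * e₆))
      regroup = solve-∀

  U+U≡2U : ∀ U → U + U ≡ 2 * U
  U+U≡2U U = cong (U +_) (sym (+-identityʳ U))

  surface⇒preimage : ∀ {A B U C} → SurfaceValuations A B U C → Preimage A B U C
  surface⇒preimage {A} {suc b} {0} {C} _ = preimage (p∣τℓ C A b) refl refl refl
  surface⇒preimage {suc _} {suc _} {suc _} {suc _} (() , _)
  surface⇒preimage {_} {suc _} {suc _} {0} (_ , T) = ⊥-elim (z-not-min T z<s z<s)
  surface⇒preimage {0} {suc b} {suc u} {suc c} (_ , T) = preimage (p∣τℓξℓ c b) refl U≡ (drop-zeros (suc c))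
    where
    gap : ∀ b u → suc b + 2 * suc u ≡ suc u + 2 * 0 + suc (b + suc u)
    gap = solve-∀
    3C≡U : 3 * suc c ≡ suc u + 2 * 0
    3C≡U = y<x⇒z≡y T (subst (suc u + 2 * 0 <_) (sym (gap b u)) (m<m+n _ z<s))
    drop-zeros : ∀ c → c + 0 + 0 + 0 + 0 ≡ c
    drop-zeros = solve-∀
    U≡ : 3 * suc c + 4 * 0 + 5 * 0 + 6 * 0 ≡ suc u
    U≡ = trans (regroup (suc c)) (trans 3C≡U (+-identityʳ (suc u)))
      where
      regroup : ∀ c → 3 * c + 4 * 0 + 5 * 0 + 6 * 0 ≡ 3 * c
      regroup = solve-∀
  surface⇒preimage {A} {0} {U} {C} (_ , T) with <-cmp (2 * A) U
  ... | tri< 2A<U _ _ = α-preimage 2A<U (y<x⇒z≡y T (subst (U + 2 * A <_) (U+U≡2U U) (+-monoʳ-< U 2A<U)))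
  ... | tri> _ _ U<2A = β-preimage U<2A (x<y⇒z≡x T (subst (_< U + 2 * A) (U+U≡2U U) (+-monoʳ-< U U<2A)))
  ... | tri≈ _ 2A≡U _ = γ-preimage 2A≡U (≮⇒≥ λ 3C<4A → z-not-min T (subst (3 * C <_) (4A≡2U A U 2A≡U) 3C<4A)
                                                                 (subst (3 * C <_) (4A≡U+2A A U 2A≡U) 3C<4A))
    where
    4A≡2U : ∀ A U → 2 * A ≡ U → 4 * A ≡ 2 * U
    4A≡2U A U refl = double A
      where
      double : ∀ A → 4 * A ≡ 2 * (2 * A)
      double = solve-∀
    4A≡U+2A : ∀ A U → 2 * A ≡ U → 4 * A ≡ U + 2 * A
    4A≡U+2A A U refl = double A
      where
      double : ∀ A → 4 * A ≡ 2 * A + 2 * A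
      double = solve-∀

  recover-preimage : ∀ {A B U C} (P : Preimage A B U C) → recover A B U C ≡ Preimage.e P
  recover-preimage (preimage s refl refl refl) = recover-shape s

module IntegerValuation where

  open import Data.Nat as ℕ using (ℕ; zero; suc; z<s)
  import Data.Nat.Properties as ℕ
  import Data.Nat.Divisibility as ℕ
  open import Data.Nat.Primality using (Prime)
  open import Data.Integer using (ℤ; +_; +[1+_]; -[1+_]; ∣_∣; 0ℤ; 1ℤ; _*_; _^_; _+_; -_; _<_; +<+)
  open import Data.Integer.GCD using (gcd)
  open import Defs using (SquareFree; gcd4)
  import Data.Integer.Properties as ℤ
  open import Data.Integer.Divisibility.Signed using (_∣_; divides; ∣ᵤ⇒∣; ∣⇒∣ᵤ; ∣m∣n⇒∣m+n; ∣m⇒∣-m)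
  open import Data.Integer.Tactic.RingSolver using (solve-∀)
  open import Data.Fin using (Fin; zero; suc)
  open import Data.Vec using (Vec; []; _∷_; lookup; replicate; zipWith; map)
  open import Data.Vec.Relation.Unary.All using (All; []; _∷_)
  open import Data.Vec.Relation.Unary.All.Properties using (lookup⁺)
  open import Relation.Binary.PropositionalEquality
  open import Data.Empty using (⊥; ⊥-elim)
  open import Data.Product using (Σ; _×_; _,_)
  open import Data.Sum using (inj₁; inj₂)
  open import Algebra.Properties.CommutativeSemigroup ℤ.*-commutativeSemigroup using (interchange)
  open Valuation
  open LocalExponents using (NoStrictMin; noStrictMin)

  -- 0 < ∣ i ∣, wrapped in a record so that i can be inferred from a proof of it.
  record Nonzero (i : ℤ) : Set where
    constructor nonzero
    field abs>0 : 0 ℕ.< ∣ i ∣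
  open Nonzero public

  νℤ : ℕ → ℤ → ℕ
  νℤ p i = ν p ∣ i ∣

  ∣i^k∣≡∣i∣^k : ∀ i k → ∣ i ^ k ∣ ≡ ∣ i ∣ ℕ.^ k
  ∣i^k∣≡∣i∣^k i zero    = refl
  ∣i^k∣≡∣i∣^k i (suc k) = trans (ℤ.abs-* i (i ^ k)) (cong (∣ i ∣ ℕ.*_) (∣i^k∣≡∣i∣^k i k))

  nonzero-* : ∀ {i j} → Nonzero i → Nonzero j → Nonzero (i * j)
  nonzero-* {i} {j} (nonzero i>0) (nonzero j>0) = nonzero (subst (0 ℕ.<_) (sym (ℤ.abs-* i j)) (ℕ.*-mono-< i>0 j>0))

  nonzero-^ : ∀ {i} k → Nonzero i → Nonzero (i ^ k)
  nonzero-^ {i} k (nonzero i>0) = nonzero (subst (0 ℕ.<_) (sym (∣i^k∣≡∣i∣^k i k)) (ℕ.m^n>0 ∣ i ∣ {{ℕ.>-nonZero i>0}} k))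

  positive-* : ∀ {i j} → 0ℤ < i → 0ℤ < j → 0ℤ < i * j
  positive-* {+[1+ _ ]} {+[1+ _ ]} _ _ = +<+ z<s
  positive-* {+ zero} (+<+ ())
  positive-* {+[1+ _ ]} {+ zero} _ (+<+ ())

  positive-^ : ∀ {i} k → 0ℤ < i → 0ℤ < i ^ k
  positive-^ zero    _   = +<+ z<s
  positive-^ (suc k) i>0 = positive-* i>0 (positive-^ k i>0)

  positive⇒nonzero : ∀ {i} → 0ℤ < i → Nonzero i
  positive⇒nonzero {+[1+ _ ]} _ = nonzero z<s
  positive⇒nonzero {+ zero} (+<+ ())

  module _ {p : ℕ} (p-prime : Prime p) where

    νℤ-* : ∀ {i j} → Nonzero i → Nonzero j → νℤ p (i * j) ≡ νℤ p i ℕ.+ νℤ p j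
    νℤ-* {i} {j} (nonzero i>0) (nonzero j>0) = trans (cong (ν p) (ℤ.abs-* i j)) (ν-* p-prime i>0 j>0)

    νℤ-^ : ∀ {i} k → Nonzero i → νℤ p (i ^ k) ≡ k ℕ.* νℤ p i
    νℤ-^ {i} k (nonzero i>0) = trans (cong (ν p) (∣i^k∣≡∣i∣^k i k)) (ν-^ p-prime k i>0)

    -- If p^(1 + ν X) divided both Y and Z, it would divide X = -(Y + Z).
    ultrametric : ∀ {X Y Z} → Nonzero X → Nonzero Y → Nonzero Z → X + Y + Z ≡ 0ℤ →
                  NoStrictMin (νℤ p X) (νℤ p Y) (νℤ p Z)
    ultrametric {X} {Y} {Z} X≢0 Y≢0 Z≢0 X+Y+Z≡0 =
      noStrictMin (not-min X Y Z X≢0 Y≢0 Z≢0 X+Y+Z≡0)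
                  (not-min Y X Z Y≢0 X≢0 Z≢0 (trans (rotate Y X Z) X+Y+Z≡0))
                  (not-min Z X Y Z≢0 X≢0 Y≢0 (trans (rotate′ Z X Y) X+Y+Z≡0))
      where
      rotate : ∀ Y X Z → Y + X + Z ≡ X + Y + Z
      rotate = solve-∀
      rotate′ : ∀ Z X Y → Z + X + Y ≡ X + Y + Z
      rotate′ = solve-∀
      X≡-[Y+Z] : ∀ X Y Z → X + Y + Z ≡ 0ℤ → X ≡ - (Y + Z)
      X≡-[Y+Z] X Y Z eq = begin
        X                           ≡⟨ solve X Y Z ⟩
        X + Y + Z + - (Y + Z)       ≡⟨ cong (_+ - (Y + Z)) eq ⟩
        0ℤ + - (Y + Z)              ≡⟨ ℤ.+-identityˡ _ ⟩
        - (Y + Z)                   ∎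
        where
        open ≡-Reasoning
        solve : ∀ X Y Z → X ≡ X + Y + Z + - (Y + Z)
        solve = solve-∀
      not-min : ∀ X Y Z → Nonzero X → Nonzero Y → Nonzero Z → X + Y + Z ≡ 0ℤ →
                νℤ p X ℕ.< νℤ p Y → νℤ p X ℕ.< νℤ p Z → ⊥
      not-min X Y Z (nonzero X>0) (nonzero Y>0) (nonzero Z>0) eq νX<νY νX<νZ = p^1+ν∤n p-prime X>0 (∣⇒∣ᵤ p^1+ν∣X)
        where
        p^1+ν∣X : + (p ℕ.^ suc (νℤ p X)) ∣ X
        p^1+ν∣X = subst (+ (p ℕ.^ suc (νℤ p X)) ∣_) (sym (X≡-[Y+Z] X Y Z eq))
                        (∣m⇒∣-m (∣m∣n⇒∣m+n (∣ᵤ⇒∣ {+ _} {Y} (k≤ν⇒p^k∣n p-prime Y>0 νX<νY)) (∣ᵤ⇒∣ {+ _} {Z} (k≤ν⇒p^k∣n p-prime Z>0 νX<νZ))))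

  infixl 7 _⊗_
  infix  8 _^ᵐ_

  data Monomial (n : ℕ) : Set where
    var  : Fin n → Monomial n
    _^ᵐ_ : Monomial n → ℕ → Monomial n
    _⊗_  : Monomial n → Monomial n → Monomial n

  module _ {n : ℕ} where

    ⟦_⟧ : Monomial n → Vec ℤ n → ℤ
    ⟦ var i ⟧  ρ = lookup ρ i
    ⟦ m ^ᵐ k ⟧ ρ = ⟦ m ⟧ ρ ^ k
    ⟦ m ⊗ m′ ⟧ ρ = ⟦ m ⟧ ρ * ⟦ m′ ⟧ ρ

    νᵐ : ℕ → Monomial n → Vec ℤ n → ℕ
    νᵐ p (var i)  ρ = νℤ p (lookup ρ i)
    νᵐ p (m ^ᵐ k) ρ = k ℕ.* νᵐ p m ρ
    νᵐ p (m ⊗ m′) ρ = νᵐ p m ρ ℕ.+ νᵐ p m′ ρ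

    ⟦⟧-nonzero : ∀ m {ρ} → All Nonzero ρ → Nonzero (⟦ m ⟧ ρ)
    ⟦⟧-nonzero (var i)  ρ≢0 = lookup⁺ ρ≢0 i
    ⟦⟧-nonzero (m ^ᵐ k) ρ≢0 = nonzero-^ k (⟦⟧-nonzero m ρ≢0)
    ⟦⟧-nonzero (m ⊗ m′) ρ≢0 = nonzero-* (⟦⟧-nonzero m ρ≢0) (⟦⟧-nonzero m′ ρ≢0)

    ⟦⟧-positive : ∀ m {ρ} → All (0ℤ <_) ρ → 0ℤ < ⟦ m ⟧ ρ
    ⟦⟧-positive (var i)  ρ>0 = lookup⁺ ρ>0 i
    ⟦⟧-positive (m ^ᵐ k) ρ>0 = positive-^ k (⟦⟧-positive m ρ>0)
    ⟦⟧-positive (m ⊗ m′) ρ>0 = positive-* (⟦⟧-positive m ρ>0) (⟦⟧-positive m′ ρ>0)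

    νℤ-⟦⟧ : ∀ {p} → Prime p → ∀ m {ρ} → All Nonzero ρ → νℤ p (⟦ m ⟧ ρ) ≡ νᵐ p m ρ
    νℤ-⟦⟧ p-prime (var i)  ρ≢0 = refl
    νℤ-⟦⟧ p-prime (m ^ᵐ k) ρ≢0 = trans (νℤ-^ p-prime k (⟦⟧-nonzero m ρ≢0)) (cong (k ℕ.*_) (νℤ-⟦⟧ p-prime m ρ≢0))
    νℤ-⟦⟧ p-prime (m ⊗ m′) ρ≢0 = trans (νℤ-* p-prime (⟦⟧-nonzero m ρ≢0) (⟦⟧-nonzero m′ ρ≢0))
                                        (cong₂ ℕ._+_ (νℤ-⟦⟧ p-prime m ρ≢0) (νℤ-⟦⟧ p-prime m′ ρ≢0))

  ⟦_⟧ᵉ : ∀ {n} → Vec ℕ n → Vec ℤ n → ℤ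
  ⟦ []     ⟧ᵉ []      = 1ℤ
  ⟦ e ∷ es ⟧ᵉ (x ∷ ρ) = x ^ e * ⟦ es ⟧ᵉ ρ

  unit : ∀ {n} → Fin n → Vec ℕ n
  unit {suc n} zero = 1 ∷ replicate n 0
  unit (suc i)      = 0 ∷ unit i

  exponents : ∀ {n} → Monomial n → Vec ℕ n
  exponents (var i)  = unit i
  exponents (m ^ᵐ k) = map (ℕ._* k) (exponents m)
  exponents (m ⊗ m′) = zipWith ℕ._+_ (exponents m) (exponents m′)

  ⟦replicate0⟧ᵉ : ∀ {n} (ρ : Vec ℤ n) → ⟦ replicate n 0 ⟧ᵉ ρ ≡ 1ℤ
  ⟦replicate0⟧ᵉ []      = refl
  ⟦replicate0⟧ᵉ (x ∷ ρ) = trans (ℤ.*-identityˡ _) (⟦replicate0⟧ᵉ ρ)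

  ⟦unit⟧ᵉ : ∀ {n} (i : Fin n) ρ → ⟦ unit i ⟧ᵉ ρ ≡ lookup ρ i
  ⟦unit⟧ᵉ zero    (x ∷ ρ) = trans (cong (x ^ 1 *_) (⟦replicate0⟧ᵉ ρ)) (trans (ℤ.*-identityʳ (x ^ 1)) (ℤ.^-identityʳ x))
  ⟦unit⟧ᵉ (suc i) (x ∷ ρ) = trans (ℤ.*-identityˡ _) (⟦unit⟧ᵉ i ρ)

  ⟦zipWith+⟧ᵉ : ∀ {n} (e f : Vec ℕ n) ρ → ⟦ zipWith ℕ._+_ e f ⟧ᵉ ρ ≡ ⟦ e ⟧ᵉ ρ * ⟦ f ⟧ᵉ ρ
  ⟦zipWith+⟧ᵉ []      []      []      = refl
  ⟦zipWith+⟧ᵉ (a ∷ e) (b ∷ f) (x ∷ ρ) = trans (cong₂ _*_ (ℤ.^-distribˡ-+-* x a b) (⟦zipWith+⟧ᵉ e f ρ))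
                                              (interchange (x ^ a) (x ^ b) (⟦ e ⟧ᵉ ρ) (⟦ f ⟧ᵉ ρ))

  ^-distribʳ-* : ∀ i j k → (i * j) ^ k ≡ i ^ k * j ^ k
  ^-distribʳ-* i j zero    = refl
  ^-distribʳ-* i j (suc k) = trans (cong (i * j *_) (^-distribʳ-* i j k)) (interchange i j (i ^ k) (j ^ k))

  ⟦map*⟧ᵉ : ∀ {n} k (e : Vec ℕ n) ρ → ⟦ map (ℕ._* k) e ⟧ᵉ ρ ≡ ⟦ e ⟧ᵉ ρ ^ k
  ⟦map*⟧ᵉ k []      []      = sym (ℤ.^-zeroˡ k)
  ⟦map*⟧ᵉ k (a ∷ e) (x ∷ ρ) = trans (cong₂ _*_ (sym (ℤ.^-*-assoc x a k)) (⟦map*⟧ᵉ k e ρ))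
                                    (sym (^-distribʳ-* (x ^ a) (⟦ e ⟧ᵉ ρ) k))

  ⟦⟧≡⟦exponents⟧ᵉ : ∀ {n} (m : Monomial n) ρ → ⟦ m ⟧ ρ ≡ ⟦ exponents m ⟧ᵉ ρ
  ⟦⟧≡⟦exponents⟧ᵉ (var i)  ρ = sym (⟦unit⟧ᵉ i ρ)
  ⟦⟧≡⟦exponents⟧ᵉ (m ^ᵐ k) ρ = trans (cong (_^ k) (⟦⟧≡⟦exponents⟧ᵉ m ρ)) (sym (⟦map*⟧ᵉ k (exponents m) ρ))
  ⟦⟧≡⟦exponents⟧ᵉ (m ⊗ m′) ρ = trans (cong₂ _*_ (⟦⟧≡⟦exponents⟧ᵉ m ρ) (⟦⟧≡⟦exponents⟧ᵉ m′ ρ))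
                                     (sym (⟦zipWith+⟧ᵉ (exponents m) (exponents m′) ρ))

  ⟦⟧-cong : ∀ {n} (m m′ : Monomial n) → exponents m ≡ exponents m′ → ∀ ρ → ⟦ m ⟧ ρ ≡ ⟦ m′ ⟧ ρ
  ⟦⟧-cong m m′ e≡e′ ρ = trans (⟦⟧≡⟦exponents⟧ᵉ m ρ) (trans (cong (λ e → ⟦ e ⟧ᵉ ρ) e≡e′) (sym (⟦⟧≡⟦exponents⟧ᵉ m′ ρ)))

  ≢0⇒nonzero : ∀ {i} → i ≢ 0ℤ → Nonzero i
  ≢0⇒nonzero {i} i≢0 = nonzero (ℕ.n≢0⇒n>0 λ ∣i∣≡0 → i≢0 (ℤ.∣i∣≡0⇒i≡0 ∣i∣≡0))

  nonzero⇒≢0 : ∀ {i} → Nonzero i → i ≢ 0ℤ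
  nonzero⇒≢0 (nonzero i>0) refl = ℕ.<-irrefl refl i>0

  positive-≡ : ∀ {i j} → 0ℤ < i → 0ℤ < j → (∀ p → Prime p → νℤ p i ≡ νℤ p j) → i ≡ j
  positive-≡ {+[1+ _ ]} {+[1+ _ ]} _ _ ν≡ν = cong +_ (≡-by-ν z<s z<s ν≡ν)
  positive-≡ {+ zero} (+<+ ())
  positive-≡ {+[1+ _ ]} {+ zero} _ (+<+ ())

  module _ {i j : ℤ} (i≢0 : Nonzero i) (j≢0 : Nonzero j) where

    νℤ-gcd : ∀ {p} → Prime p → νℤ p (gcd i j) ≡ νℤ p i ℕ.⊓ νℤ p j
    νℤ-gcd p-prime = ν-gcd p-prime (abs>0 i≢0) (abs>0 j≢0)

    gcd-nonzero : Nonzero (gcd i j)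
    gcd-nonzero = nonzero (gcd>0 (abs>0 i≢0))

    gcd≡1⇒⊓≡0 : gcd i j ≡ 1ℤ → ∀ p → Prime p → νℤ p i ℕ.⊓ νℤ p j ≡ 0
    gcd≡1⇒⊓≡0 g≡1 p p-prime = trans (sym (νℤ-gcd p-prime)) (≡1⇒ν≡0 (ℤ.+-injective g≡1) p p-prime)

    ⊓≡0⇒gcd≡1 : (∀ p → Prime p → νℤ p i ℕ.⊓ νℤ p j ≡ 0) → gcd i j ≡ 1ℤ
    ⊓≡0⇒gcd≡1 ⊓≡0 = cong +_ (ν≡0⇒≡1 (abs>0 gcd-nonzero) λ p p-prime → trans (νℤ-gcd p-prime) (⊓≡0 p p-prime))

  module _ {n : ℤ} (n≢0 : Nonzero n) where

    squarefree⇒νℤ≤1 : SquareFree n → ∀ p → Prime p → νℤ p n ℕ.≤ 1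
    squarefree⇒νℤ≤1 sqf = squarefree⇒ν≤1 (abs>0 n≢0) λ d d²∣n → sqf (+ d) (subst (ℕ._∣ ∣ n ∣) (sym (ℤ.abs-* (+ d) (+ d))) d²∣n)

    νℤ≤1⇒squarefree : (∀ p → Prime p → νℤ p n ℕ.≤ 1) → SquareFree n
    νℤ≤1⇒squarefree ν≤1 d d²∣n = ν≤1⇒squarefree (abs>0 n≢0) ν≤1 ∣ d ∣ (subst (ℕ._∣ ∣ n ∣) (ℤ.abs-* d d) d²∣n)

  nonzero-*⁻¹ : ∀ i j → Nonzero (i * j) → Nonzero i × Nonzero j
  nonzero-*⁻¹ i j (nonzero ij>0) = nonzero (m*n>0⇒m>0 (∣ i ∣) abs-ij>0) , nonzero (m*n>0⇒m>0 (∣ j ∣) (subst (0 ℕ.<_) (ℕ.*-comm ∣ i ∣ ∣ j ∣) abs-ij>0))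
    where
    abs-ij>0 = subst (0 ℕ.<_) (ℤ.abs-* i j) ij>0

  ∃-with-νℤ : ∀ (f : ℕ → ℕ) N → (∀ q → Prime q → N ℕ.< q → f q ≡ 0) →
              Σ ℤ λ ξ → 0ℤ < ξ × ∀ q → Prime q → νℤ q ξ ≡ f q
  ∃-with-νℤ f N f≡0 with ∃-with-valuations f N f≡0
  ... | suc n , _ , ν≡f = +[1+ n ] , +<+ z<s , ν≡f

  factor : ∀ {m a} → Nonzero m → Nonzero a → (∀ q → Prime q → νℤ q m ℕ.≤ νℤ q a) → Σ ℤ λ τ → a ≡ m * τ
  factor {m} {a} (nonzero m>0) (nonzero a>0) ν≤ν with ∣ᵤ⇒∣ {m} {a} (∣-by-ν m>0 a>0 ν≤ν)
  ... | divides τ a≡τm = τ , trans a≡τm (ℤ.*-comm τ m)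

  positive-factor : ∀ {m a} → 0ℤ < m → 0ℤ < a → (∀ q → Prime q → νℤ q m ℕ.≤ νℤ q a) → Σ ℤ λ τ → 0ℤ < τ × a ≡ m * τ
  positive-factor {m} {a} m>0 a>0 ν≤ν with factor {m} {a} (positive⇒nonzero m>0) (positive⇒nonzero a>0) ν≤ν
  ... | τ , a≡mτ = τ , cofactor>0 m>0 (subst (0ℤ <_) a≡mτ a>0) , a≡mτ
    where
    cofactor>0 : ∀ {m τ} → 0ℤ < m → 0ℤ < m * τ → 0ℤ < τ
    cofactor>0 {+[1+ _ ]} {+[1+ _ ]} _ _ = +<+ z<s
    cofactor>0 {m} {+ zero} _ mτ>0 = ⊥-elim (ℤ.<-irrefl refl (subst (0ℤ <_) (ℤ.*-zeroʳ m) mτ>0))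
    cofactor>0 {+[1+ _ ]} { -[1+ _ ]} _ ()
    cofactor>0 {+ zero} (+<+ ())

  module _ {a b c d : ℤ} (a≢0 : Nonzero a) (b≢0 : Nonzero b) (c≢0 : Nonzero c) (d≢0 : Nonzero d) where

    private
      νℤ-gcd4 : ∀ {p} → Prime p → νℤ p (gcd4 a b c d) ≡ νℤ p a ℕ.⊓ νℤ p b ℕ.⊓ νℤ p c ℕ.⊓ νℤ p d
      νℤ-gcd4 {p} p-prime = begin
        νℤ p (gcd4 a b c d)                                 ≡⟨ νℤ-gcd (gcd-nonzero (gcd-nonzero a≢0 b≢0) c≢0) d≢0 p-prime ⟩
        νℤ p (gcd (gcd a b) c) ℕ.⊓ νℤ p d                   ≡⟨ cong (ℕ._⊓ νℤ p d) (νℤ-gcd (gcd-nonzero a≢0 b≢0) c≢0 p-prime) ⟩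
        νℤ p (gcd a b) ℕ.⊓ νℤ p c ℕ.⊓ νℤ p d                ≡⟨ cong (λ m → m ℕ.⊓ νℤ p c ℕ.⊓ νℤ p d) (νℤ-gcd a≢0 b≢0 p-prime) ⟩
        νℤ p a ℕ.⊓ νℤ p b ℕ.⊓ νℤ p c ℕ.⊓ νℤ p d             ∎
        where open ≡-Reasoning

    gcd4≡1⇒⊓≡0 : gcd4 a b c d ≡ 1ℤ → ∀ p → Prime p → νℤ p a ℕ.⊓ νℤ p b ℕ.⊓ νℤ p c ℕ.⊓ νℤ p d ≡ 0
    gcd4≡1⇒⊓≡0 g≡1 p p-prime = trans (sym (νℤ-gcd4 p-prime)) (≡1⇒ν≡0 (ℤ.+-injective g≡1) p p-prime)

    ⊓≡0⇒gcd4≡1 : (∀ p → Prime p → νℤ p a ℕ.⊓ νℤ p b ℕ.⊓ νℤ p c ℕ.⊓ νℤ p d ≡ 0) → gcd4 a b c d ≡ 1ℤ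
    ⊓≡0⇒gcd4≡1 ⊓≡0 = cong +_ (ν≡0⇒≡1 (abs>0 (gcd-nonzero (gcd-nonzero (gcd-nonzero a≢0 b≢0) c≢0) d≢0))
                                     λ p p-prime → trans (νℤ-gcd4 p-prime) (⊓≡0 p p-prime))

  nonzero*j≡0⇒j≡0 : ∀ {i} j → Nonzero i → i * j ≡ 0ℤ → j ≡ 0ℤ
  nonzero*j≡0⇒j≡0 {i} j i≢0 ij≡0 with ℤ.i*j≡0⇒i≡0∨j≡0 i ij≡0
  ... | inj₁ i≡0 = ⊥-elim (nonzero⇒≢0 i≢0 i≡0)
  ... | inj₂ j≡0 = j≡0

open import Defs
open import Data.Nat as ℕ using (ℕ; _⊓_)
import Data.Nat.Properties as ℕ
open import Data.Nat.Primality using (Prime)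
open import Data.Integer using (ℤ; ∣_∣; 0ℤ; 1ℤ; _*_; _^_; _+_; _<_)
import Data.Integer.Properties as ℤ
open import Data.Integer.GCD using (gcd)
open import Data.Fin using (#_)
open import Data.Vec using (Vec; []; _∷_; lookup; tabulate)
open import Data.Vec.Properties using (lookup-replicate)
open import Data.Vec.Relation.Unary.All as All using (All; []; _∷_)
open import Data.Vec.Relation.Unary.All.Properties using (lookup⁺; tabulate⁺; ++⁺)
open import Data.Product using (Σ; _×_; _,_; proj₁; proj₂)
open import Relation.Binary.PropositionalEquality
open Valuation
open LocalExponents
open IntegerValuation

ξ₁ᵛ ξ₂ᵛ ξ₃ᵛ ξℓᵛ ξ₄ᵛ ξ₅ᵛ ξ₆ᵛ : ∀ {k} → Monomial (7 ℕ.+ k)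
ξ₁ᵛ = var (# 0)
ξ₂ᵛ = var (# 1)
ξ₃ᵛ = var (# 2)
ξℓᵛ = var (# 3)
ξ₄ᵛ = var (# 4)
ξ₅ᵛ = var (# 5)
ξ₆ᵛ = var (# 6)

τ₁ᵛ τ₂ᵛ τℓᵛ : Monomial 10
τ₁ᵛ = var (# 7)
τ₂ᵛ = var (# 8)
τℓᵛ = var (# 9)

-- Ψ t = (M₀ τ₂, τℓ, M₂, M₃ τ₁). Monomials in the ξ's are polymorphic in the number of extra variables,
-- so that they evaluate both on the ξ's alone and on all ten variables.
M₀ M₂ M₃ : ∀ {k} → Monomial (7 ℕ.+ k)
M₀ = ξ₁ᵛ ⊗ ξ₂ᵛ ^ᵐ 2 ⊗ ξ₃ᵛ ^ᵐ 2 ⊗ ξ₄ᵛ ⊗ ξ₅ᵛ ^ᵐ 2 ⊗ ξ₆ᵛ ^ᵐ 3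
M₂ = ξ₁ᵛ ^ᵐ 2 ⊗ ξ₂ᵛ ^ᵐ 3 ⊗ ξ₃ᵛ ^ᵐ 4 ⊗ ξℓᵛ ^ᵐ 3 ⊗ ξ₄ᵛ ^ᵐ 4 ⊗ ξ₅ᵛ ^ᵐ 5 ⊗ ξ₆ᵛ ^ᵐ 6
M₃ = ξ₁ᵛ ^ᵐ 2 ⊗ ξ₂ᵛ ^ᵐ 2 ⊗ ξ₃ᵛ ^ᵐ 3 ⊗ ξℓᵛ ⊗ ξ₄ᵛ ^ᵐ 2 ⊗ ξ₅ᵛ ^ᵐ 3 ⊗ ξ₆ᵛ ^ᵐ 4

K : ∀ {k} → Monomial (7 ℕ.+ k)
K = ξ₁ᵛ ^ᵐ 4 ⊗ ξ₂ᵛ ^ᵐ 6 ⊗ ξ₃ᵛ ^ᵐ 8 ⊗ ξℓᵛ ^ᵐ 3 ⊗ ξ₄ᵛ ^ᵐ 6 ⊗ ξ₅ᵛ ^ᵐ 9 ⊗ ξ₆ᵛ ^ᵐ 12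

T₁ T₂ T₃ : Monomial 10
T₁ = τℓᵛ ⊗ ξℓᵛ ^ᵐ 3 ⊗ ξ₄ᵛ ^ᵐ 2 ⊗ ξ₅ᵛ
T₂ = τ₂ᵛ ^ᵐ 2 ⊗ ξ₂ᵛ
T₃ = τ₁ᵛ ^ᵐ 3 ⊗ ξ₁ᵛ ^ᵐ 2 ⊗ ξ₃ᵛ

ξs : Param → Vec ℤ 7
ξs (param ξ₁ ξ₂ ξ₃ ξℓ ξ₄ ξ₅ ξ₆ _ _ _) = ξ₁ ∷ ξ₂ ∷ ξ₃ ∷ ξℓ ∷ ξ₄ ∷ ξ₅ ∷ ξ₆ ∷ []

vars : Param → Vec ℤ 10
vars (param ξ₁ ξ₂ ξ₃ ξℓ ξ₄ ξ₅ ξ₆ τ₁ τ₂ τℓ) = ξ₁ ∷ ξ₂ ∷ ξ₃ ∷ ξℓ ∷ ξ₄ ∷ ξ₅ ∷ ξ₆ ∷ τ₁ ∷ τ₂ ∷ τℓ ∷ []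

torsor : Param → ℤ
torsor (param ξ₁ ξ₂ ξ₃ ξℓ ξ₄ ξ₅ ξ₆ τ₁ τ₂ τℓ) = τℓ * ξℓ ^ 3 * ξ₄ ^ 2 * ξ₅ + τ₂ ^ 2 * ξ₂ + τ₁ ^ 3 * ξ₁ ^ 2 * ξ₃

surface : ℤ⁴ → ℤ
surface ⟨ x₀ , x₁ , x₂ , x₃ ⟩ = x₁ * x₂ ^ 2 + x₂ * x₀ ^ 2 + x₃ ^ 3

surface∘Ψ : ∀ t → surface (Ψ t) ≡ ⟦ K ⟧ (vars t) * torsor t
surface∘Ψ t@(param _ _ _ _ _ _ _ _ _ _) = begin
  surface (Ψ t)                                           ≡⟨ cong₂ _+_ (cong₂ _+_ (⟦⟧-cong (τℓᵛ ⊗ M₂ ^ᵐ 2) (K ⊗ T₁) refl ρ)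
                                                                                (⟦⟧-cong (M₂ ⊗ (M₀ ⊗ τ₂ᵛ) ^ᵐ 2) (K ⊗ T₂) refl ρ))
                                                                    (⟦⟧-cong ((M₃ ⊗ τ₁ᵛ) ^ᵐ 3) (K ⊗ T₃) refl ρ) ⟩
  k * ⟦ T₁ ⟧ ρ + k * ⟦ T₂ ⟧ ρ + k * ⟦ T₃ ⟧ ρ                ≡⟨ cong (_+ k * ⟦ T₃ ⟧ ρ) (ℤ.*-distribˡ-+ k (⟦ T₁ ⟧ ρ) (⟦ T₂ ⟧ ρ)) ⟨
  k * (⟦ T₁ ⟧ ρ + ⟦ T₂ ⟧ ρ) + k * ⟦ T₃ ⟧ ρ                  ≡⟨ ℤ.*-distribˡ-+ k _ (⟦ T₃ ⟧ ρ) ⟨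
  k * torsor t                                            ∎
  where
  open ≡-Reasoning
  ρ = vars t
  k = ⟦ K ⟧ ρ

CoprimeConditions : Param → Set
CoprimeConditions (param ξ₁ ξ₂ ξ₃ ξℓ ξ₄ ξ₅ ξ₆ τ₁ τ₂ τℓ) =
  gcd τ₂ (ξ₁ * ξ₃) ≡ 1ℤ × gcd τℓ (ξ₄ * ξ₅ * ξ₆) ≡ 1ℤ × SquareFree (ξ₂ * ξ₃ * ξ₄ * ξ₅)
  × gcd ξ₁ ξ₂ ≡ 1ℤ × gcd τ₁ (ξ₂ * ξ₃ * ξℓ * ξ₄ * ξ₅ * ξ₆) ≡ 1ℤ

exponentsOf : ℕ → Vec ℤ 7 → Exponents
exponentsOf p (ξ₁ ∷ ξ₂ ∷ ξ₃ ∷ ξℓ ∷ ξ₄ ∷ ξ₅ ∷ ξ₆ ∷ []) =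
  exps (νℤ p ξ₁) (νℤ p ξ₂) (νℤ p ξ₃) (νℤ p ξℓ) (νℤ p ξ₄) (νℤ p ξ₅) (νℤ p ξ₆)

exponentsAt : ℕ → Param → Exponents
exponentsAt p t = exponentsOf p (ξs t)

LocalCoprimality LocalTorsor : ℕ → Param → Set
LocalCoprimality p t = Coprimality (exponentsAt p t) (νℤ p (Param.τ₁ t)) (νℤ p (Param.τ₂ t)) (νℤ p (Param.τℓ t))
LocalTorsor p t = TorsorValuations (exponentsAt p t) (νℤ p (Param.τ₁ t)) (νℤ p (Param.τ₂ t)) (νℤ p (Param.τℓ t))

ξ₁ξ₃ ξ₄ξ₅ξ₆ ξ₂ξ₃ξ₄ξ₅ ξ₂ξ₃ξℓξ₄ξ₅ξ₆ : Monomial 10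
ξ₁ξ₃ = ξ₁ᵛ ⊗ ξ₃ᵛ
ξ₄ξ₅ξ₆ = ξ₄ᵛ ⊗ ξ₅ᵛ ⊗ ξ₆ᵛ
ξ₂ξ₃ξ₄ξ₅ = ξ₂ᵛ ⊗ ξ₃ᵛ ⊗ ξ₄ᵛ ⊗ ξ₅ᵛ
ξ₂ξ₃ξℓξ₄ξ₅ξ₆ = ξ₂ᵛ ⊗ ξ₃ᵛ ⊗ ξℓᵛ ⊗ ξ₄ᵛ ⊗ ξ₅ᵛ ⊗ ξ₆ᵛ

module _ {n} {ρ : Vec ℤ n} (ρ≢0 : All Nonzero ρ) where

  coprime⇒local : ∀ {i} m → Nonzero i → gcd i (⟦ m ⟧ ρ) ≡ 1ℤ → ∀ p → Prime p → νℤ p i ⊓ νᵐ p m ρ ≡ 0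
  coprime⇒local {i} m i≢0 g≡1 p p-prime =
    trans (cong (νℤ p i ⊓_) (sym (νℤ-⟦⟧ p-prime m ρ≢0))) (gcd≡1⇒⊓≡0 i≢0 (⟦⟧-nonzero m ρ≢0) g≡1 p p-prime)

  local⇒coprime : ∀ {i} m → Nonzero i → (∀ p → Prime p → νℤ p i ⊓ νᵐ p m ρ ≡ 0) → gcd i (⟦ m ⟧ ρ) ≡ 1ℤ
  local⇒coprime {i} m i≢0 ν⊓ν≡0 = ⊓≡0⇒gcd≡1 i≢0 (⟦⟧-nonzero m ρ≢0) λ p p-prime →
    trans (cong (νℤ p i ⊓_) (νℤ-⟦⟧ p-prime m ρ≢0)) (ν⊓ν≡0 p p-prime)

  squarefree⇒local : ∀ m → SquareFree (⟦ m ⟧ ρ) → ∀ p → Prime p → νᵐ p m ρ ℕ.≤ 1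
  squarefree⇒local m sqf p p-prime =
    subst (ℕ._≤ 1) (νℤ-⟦⟧ p-prime m ρ≢0) (squarefree⇒νℤ≤1 (⟦⟧-nonzero m ρ≢0) sqf p p-prime)

  local⇒squarefree : ∀ m → (∀ p → Prime p → νᵐ p m ρ ℕ.≤ 1) → SquareFree (⟦ m ⟧ ρ)
  local⇒squarefree m ν≤1 = νℤ≤1⇒squarefree (⟦⟧-nonzero m ρ≢0) λ p p-prime →
    subst (ℕ._≤ 1) (sym (νℤ-⟦⟧ p-prime m ρ≢0)) (ν≤1 p p-prime)

coprimality⇒local : ∀ t → All Nonzero (vars t) → CoprimeConditions t → ∀ p → Prime p → LocalCoprimality p t
coprimality⇒local (param _ _ _ _ _ _ _ _ _ _) t≢0 (g₁ , g₂ , sqf , g₃ , g₄) p p-prime =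
    coprime⇒local t≢0 ξ₁ξ₃ (lookup⁺ t≢0 (# 8)) g₁ p p-prime
  , coprime⇒local t≢0 ξ₄ξ₅ξ₆ (lookup⁺ t≢0 (# 9)) g₂ p p-prime
  , squarefree⇒local t≢0 ξ₂ξ₃ξ₄ξ₅ sqf p p-prime
  , coprime⇒local t≢0 ξ₂ᵛ (lookup⁺ t≢0 (# 0)) g₃ p p-prime
  , coprime⇒local t≢0 ξ₂ξ₃ξℓξ₄ξ₅ξ₆ (lookup⁺ t≢0 (# 7)) g₄ p p-prime

local⇒coprimality : ∀ t → All Nonzero (vars t) → (∀ p → Prime p → LocalCoprimality p t) → CoprimeConditions t
local⇒coprimality (param _ _ _ _ _ _ _ _ _ _) t≢0 local =
    local⇒coprime t≢0 ξ₁ξ₃ (lookup⁺ t≢0 (# 8)) (λ p p-prime → proj₁ (local p p-prime))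
  , local⇒coprime t≢0 ξ₄ξ₅ξ₆ (lookup⁺ t≢0 (# 9)) (λ p p-prime → proj₁ (proj₂ (local p p-prime)))
  , local⇒squarefree t≢0 ξ₂ξ₃ξ₄ξ₅ (λ p p-prime → proj₁ (proj₂ (proj₂ (local p p-prime))))
  , local⇒coprime t≢0 ξ₂ᵛ (lookup⁺ t≢0 (# 0)) (λ p p-prime → proj₁ (proj₂ (proj₂ (proj₂ (local p p-prime)))))
  , local⇒coprime t≢0 ξ₂ξ₃ξℓξ₄ξ₅ξ₆ (lookup⁺ t≢0 (# 7)) (λ p p-prime → proj₂ (proj₂ (proj₂ (proj₂ (local p p-prime)))))

torsor⇒local : ∀ t → All Nonzero (vars t) → torsor t ≡ 0ℤ → ∀ p → Prime p → LocalTorsor p t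
torsor⇒local t@(param _ _ _ _ _ _ _ _ _ _) t≢0 torsor≡0 p p-prime =
  noStrictMin-resp (νℤ-⟦⟧ p-prime T₁ t≢0) (νℤ-⟦⟧ p-prime T₂ t≢0) (νℤ-⟦⟧ p-prime T₃ t≢0)
    (ultrametric p-prime (⟦⟧-nonzero T₁ t≢0) (⟦⟧-nonzero T₂ t≢0) (⟦⟧-nonzero T₃ t≢0) torsor≡0)

𝓣₂⇒ξ>0 : ∀ t → 𝓣₂ t → All (0ℤ <_) (ξs t)
𝓣₂⇒ξ>0 (param _ _ _ _ _ _ _ _ _ _) ((h₁ , h₂ , h₃ , hℓ , h₄ , h₅ , h₆) , _) = h₁ ∷ h₂ ∷ h₃ ∷ hℓ ∷ h₄ ∷ h₅ ∷ h₆ ∷ []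

𝓣₂⇒nonzero : ∀ t → 𝓣₂ t → All Nonzero (vars t)
𝓣₂⇒nonzero (param _ _ _ _ _ _ _ _ _ _) ((h₁ , h₂ , h₃ , hℓ , h₄ , h₅ , h₆) , τ₁≢0 , τ₂>0 , τℓ≢0 , _) =
  positive⇒nonzero h₁ ∷ positive⇒nonzero h₂ ∷ positive⇒nonzero h₃ ∷ positive⇒nonzero hℓ ∷ positive⇒nonzero h₄ ∷
  positive⇒nonzero h₅ ∷ positive⇒nonzero h₆ ∷ ≢0⇒nonzero τ₁≢0 ∷ positive⇒nonzero τ₂>0 ∷ ≢0⇒nonzero τℓ≢0 ∷ []

shape-at : ∀ t → 𝓣₂ t → ∀ p → Prime p →
           Shape (exponentsAt p t) (νℤ p (Param.τ₁ t)) (νℤ p (Param.τ₂ t)) (νℤ p (Param.τℓ t))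
shape-at t@(param _ _ _ _ _ _ _ _ _ _) T@(_ , _ , _ , _ , torsor≡0 , coprime) p p-prime =
  shape (coprimality⇒local t t≢0 coprime p p-prime) (torsor⇒local t t≢0 torsor≡0 p p-prime)
  where t≢0 = 𝓣₂⇒nonzero t T

recoverAt : ℕ → ℤ⁴ → Exponents
recoverAt p ⟨ x₀ , x₁ , x₂ , x₃ ⟩ = recover (νℤ p x₀) (νℤ p x₁) (νℤ p x₂) (νℤ p x₃)

recover-Ψ : ∀ t → 𝓣₂ t → ∀ p → Prime p → recoverAt p (Ψ t) ≡ exponentsAt p t
recover-Ψ t@(param _ _ _ _ _ _ _ τ₁ τ₂ τℓ) T p p-prime =
  trans (recover-cong (νℤ-⟦⟧ p-prime (M₀ ⊗ τ₂ᵛ) t≢0) (νℤ-⟦⟧ p-prime M₂ t≢0) (νℤ-⟦⟧ p-prime (M₃ ⊗ τ₁ᵛ) t≢0))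
        (recover-shape (shape-at t T p p-prime))
  where
  t≢0 = 𝓣₂⇒nonzero t T
  recover-cong : ∀ {A A′ U U′ C C′} → A ≡ A′ → U ≡ U′ → C ≡ C′ → recover A (νℤ p τℓ) U C ≡ recover A′ (νℤ p τℓ) U′ C′
  recover-cong refl refl refl = refl

Ψ-into : ∀ t → 𝓣₂ t → 𝓔 (Ψ t)
Ψ-into t@(param _ _ _ _ _ _ _ τ₁ τ₂ τℓ) T@(_ , _ , τ₂>0 , _ , torsor≡0 , _) =
  ⊓≡0⇒gcd4≡1 {ℤ⁴.x₀ (Ψ t)} {τℓ} {ℤ⁴.x₂ (Ψ t)} {ℤ⁴.x₃ (Ψ t)} (⟦⟧-nonzero (M₀ ⊗ τ₂ᵛ) t≢0) (lookup⁺ t≢0 (# 9)) (⟦⟧-nonzero M₂ t≢0) (⟦⟧-nonzero (M₃ ⊗ τ₁ᵛ) t≢0) ⊓≡0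
  , nonzero⇒≢0 (⟦⟧-nonzero (M₀ ⊗ τ₂ᵛ ⊗ τℓᵛ ⊗ M₂ ⊗ (M₃ ⊗ τ₁ᵛ)) t≢0)
  , positive-* (⟦⟧-positive M₀ ξ>0) τ₂>0
  , ⟦⟧-positive M₂ ξ>0
  , trans (surface∘Ψ t) (trans (cong (⟦ K ⟧ (vars t) *_) torsor≡0) (ℤ.*-zeroʳ (⟦ K ⟧ (vars t))))
  where
  t≢0 = 𝓣₂⇒nonzero t T
  ξ>0 = 𝓣₂⇒ξ>0 t T
  ⊓≡0 : ∀ p → Prime p → νℤ p (⟦ M₀ ⊗ τ₂ᵛ ⟧ (vars t)) ⊓ νℤ p τℓ ⊓ νℤ p (⟦ M₂ ⟧ (vars t)) ⊓ νℤ p (⟦ M₃ ⊗ τ₁ᵛ ⟧ (vars t)) ≡ 0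
  ⊓≡0 p p-prime = begin
    νℤ p (⟦ M₀ ⊗ τ₂ᵛ ⟧ (vars t)) ⊓ νℤ p τℓ ⊓ νℤ p (⟦ M₂ ⟧ (vars t)) ⊓ νℤ p (⟦ M₃ ⊗ τ₁ᵛ ⟧ (vars t))
      ≡⟨ cong₂ (λ A U → A ⊓ νℤ p τℓ ⊓ U ⊓ νℤ p (⟦ M₃ ⊗ τ₁ᵛ ⟧ (vars t))) (νℤ-⟦⟧ p-prime (M₀ ⊗ τ₂ᵛ) t≢0) (νℤ-⟦⟧ p-prime M₂ t≢0) ⟩
    νᵐ p (M₀ ⊗ τ₂ᵛ) (vars t) ⊓ νℤ p τℓ ⊓ νᵐ p M₂ (vars t) ⊓ νℤ p (⟦ M₃ ⊗ τ₁ᵛ ⟧ (vars t))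
      ≡⟨ cong (νᵐ p (M₀ ⊗ τ₂ᵛ) (vars t) ⊓ νℤ p τℓ ⊓ νᵐ p M₂ (vars t) ⊓_) (νℤ-⟦⟧ p-prime (M₃ ⊗ τ₁ᵛ) t≢0) ⟩
    νᵐ p (M₀ ⊗ τ₂ᵛ) (vars t) ⊓ νℤ p τℓ ⊓ νᵐ p M₂ (vars t) ⊓ νᵐ p (M₃ ⊗ τ₁ᵛ) (vars t)
      ≡⟨ shape⇒image-coprime (shape-at t T p p-prime) ⟩
    0 ∎
    where open ≡-Reasoning

param-≡ : ∀ {s t} → ξs s ≡ ξs t → Param.τ₁ s ≡ Param.τ₁ t → Param.τ₂ s ≡ Param.τ₂ t → Param.τℓ s ≡ Param.τℓ t → s ≡ t
param-≡ {param _ _ _ _ _ _ _ _ _ _} {param _ _ _ _ _ _ _ _ _ _} refl refl refl refl = refl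

Ψ-injective : ∀ s t → 𝓣₂ s → 𝓣₂ t → Ψ s ≡ Ψ t → s ≡ t
Ψ-injective s@(param _ _ _ _ _ _ _ σ₁ σ₂ _) t@(param _ _ _ _ _ _ _ τ₁ τ₂ _) S T Ψs≡Ψt =
  param-≡ ξs≡ (cancel M₃ ℤ⁴.x₃ refl refl) (cancel M₀ ℤ⁴.x₀ refl refl) (cong ℤ⁴.x₁ Ψs≡Ψt)
  where
  exponents≡ : (f : Exponents → ℕ) → ∀ p → Prime p → f (exponentsAt p s) ≡ f (exponentsAt p t)
  exponents≡ f p p-prime =
    cong f (trans (sym (recover-Ψ s S p p-prime)) (trans (cong (recoverAt p) Ψs≡Ψt) (recover-Ψ t T p p-prime)))
  S>0 = 𝓣₂⇒ξ>0 s S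
  T>0 = 𝓣₂⇒ξ>0 t T
  ξs≡ : ξs s ≡ ξs t
  ξs≡ = cong₂ _∷_ (positive-≡ (lookup⁺ S>0 (# 0)) (lookup⁺ T>0 (# 0)) (exponents≡ Exponents.e₁))
       (cong₂ _∷_ (positive-≡ (lookup⁺ S>0 (# 1)) (lookup⁺ T>0 (# 1)) (exponents≡ Exponents.e₂))
       (cong₂ _∷_ (positive-≡ (lookup⁺ S>0 (# 2)) (lookup⁺ T>0 (# 2)) (exponents≡ Exponents.e₃))
       (cong₂ _∷_ (positive-≡ (lookup⁺ S>0 (# 3)) (lookup⁺ T>0 (# 3)) (exponents≡ Exponents.eℓ))
       (cong₂ _∷_ (positive-≡ (lookup⁺ S>0 (# 4)) (lookup⁺ T>0 (# 4)) (exponents≡ Exponents.e₄))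
       (cong₂ _∷_ (positive-≡ (lookup⁺ S>0 (# 5)) (lookup⁺ T>0 (# 5)) (exponents≡ Exponents.e₅))
       (cong₂ _∷_ (positive-≡ (lookup⁺ S>0 (# 6)) (lookup⁺ T>0 (# 6)) (exponents≡ Exponents.e₆)) refl))))))
  cancel : (m : Monomial 7) (x : ℤ⁴ → ℤ) {σ τ : ℤ} → x (Ψ s) ≡ ⟦ m ⟧ (ξs s) * σ → x (Ψ t) ≡ ⟦ m ⟧ (ξs t) * τ → σ ≡ τ
  cancel m x {σ} {τ} xs≡ xt≡ = ℤ.*-cancelˡ-≡ (⟦ m ⟧ (ξs s)) σ τ {{ℕ.>-nonZero (abs>0 m≢0)}}
    (trans (sym xs≡) (trans (cong x Ψs≡Ψt) (trans xt≡ (cong (λ ξ → ⟦ m ⟧ ξ * τ) (sym ξs≡)))))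
    where m≢0 = ⟦⟧-nonzero m (All.map positive⇒nonzero S>0)

𝓔⇒nonzero : ∀ {a b u c} → 𝓔 ⟨ a , b , u , c ⟩ → All Nonzero (a ∷ b ∷ u ∷ c ∷ [])
𝓔⇒nonzero {a} {b} {u} {c} (_ , abuc≢0 , _)
  with nonzero-*⁻¹ (a * b * u) c (≢0⇒nonzero abuc≢0)
... | abu≢0 , c≢0 with nonzero-*⁻¹ (a * b) u abu≢0
...   | ab≢0 , u≢0 with nonzero-*⁻¹ a b ab≢0
...     | a≢0 , b≢0 = a≢0 ∷ b≢0 ∷ u≢0 ∷ c≢0 ∷ []

surface⇒local : ∀ {a b u c} → 𝓔 ⟨ a , b , u , c ⟩ → ∀ p → Prime p →
                SurfaceValuations (νℤ p a) (νℤ p b) (νℤ p u) (νℤ p c)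
surface⇒local E@(gcd≡1 , _ , _ , _ , surface≡0) p p-prime =
    gcd4≡1⇒⊓≡0 (lookup⁺ x≢0 (# 0)) (lookup⁺ x≢0 (# 1)) (lookup⁺ x≢0 (# 2)) (lookup⁺ x≢0 (# 3)) gcd≡1 p p-prime
  , noStrictMin-resp (νℤ-⟦⟧ p-prime x₁x₂² x≢0) (νℤ-⟦⟧ p-prime x₂x₀² x≢0) (νℤ-⟦⟧ p-prime x₃³ x≢0)
      (ultrametric p-prime (⟦⟧-nonzero x₁x₂² x≢0) (⟦⟧-nonzero x₂x₀² x≢0) (⟦⟧-nonzero x₃³ x≢0) surface≡0)
  where
  x≢0 = 𝓔⇒nonzero E
  x₁x₂² x₂x₀² x₃³ : Monomial 4
  x₁x₂² = var (# 1) ⊗ var (# 2) ^ᵐ 2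
  x₂x₀² = var (# 2) ⊗ var (# 0) ^ᵐ 2
  x₃³   = var (# 3) ^ᵐ 3

exponentList : Exponents → Vec ℕ 7
exponentList e = Exponents.e₁ e ∷ Exponents.e₂ e ∷ Exponents.e₃ e ∷ Exponents.eℓ e ∷ Exponents.e₄ e ∷ Exponents.e₅ e ∷ Exponents.e₆ e ∷ []

realize-exponents : ∀ x → 𝓔 x → Σ (Vec ℤ 7) λ ξ → All (0ℤ <_) ξ × ∀ q → Prime q → exponentsOf q ξ ≡ recoverAt q x
realize-exponents x@(⟨ a , b , u , c ⟩) E =
  tabulate (λ i → proj₁ (with-exponent i)) ,
  tabulate⁺ (λ i → proj₁ (proj₂ (with-exponent i))) ,
  λ q q-prime → exps-cong (ν≡ (# 0) q q-prime) (ν≡ (# 1) q q-prime) (ν≡ (# 2) q q-prime) (ν≡ (# 3) q q-prime)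
                          (ν≡ (# 4) q q-prime) (ν≡ (# 5) q q-prime) (ν≡ (# 6) q q-prime)
  where
  x≢0 = 𝓔⇒nonzero E
  N = ∣ a ∣ ℕ.+ ∣ b ∣ ℕ.+ ∣ u ∣ ℕ.+ ∣ c ∣
  -- primes beyond N divide none of a, b, u, c
  vanish : ∀ q → Prime q → N ℕ.< q → recoverAt q x ≡ exps 0 0 0 0 0 0 0
  vanish q _ N<q
    rewrite ν-large (abs>0 (lookup⁺ x≢0 (# 0))) (ℕ.≤-<-trans (ℕ.≤-trans (ℕ.m≤m+n ∣ a ∣ ∣ b ∣) (ℕ.≤-trans (ℕ.m≤m+n _ ∣ u ∣) (ℕ.m≤m+n _ ∣ c ∣))) N<q)
          | ν-large (abs>0 (lookup⁺ x≢0 (# 1))) (ℕ.≤-<-trans (ℕ.≤-trans (ℕ.m≤n+m ∣ b ∣ ∣ a ∣) (ℕ.≤-trans (ℕ.m≤m+n _ ∣ u ∣) (ℕ.m≤m+n _ ∣ c ∣))) N<q)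
          | ν-large (abs>0 (lookup⁺ x≢0 (# 2))) (ℕ.≤-<-trans (ℕ.≤-trans (ℕ.m≤n+m ∣ u ∣ (∣ a ∣ ℕ.+ ∣ b ∣)) (ℕ.m≤m+n _ ∣ c ∣)) N<q)
          | ν-large (abs>0 (lookup⁺ x≢0 (# 3))) (ℕ.≤-<-trans (ℕ.m≤n+m ∣ c ∣ (∣ a ∣ ℕ.+ ∣ b ∣ ℕ.+ ∣ u ∣)) N<q) = refl
  with-exponent : ∀ i → Σ ℤ λ ξ → 0ℤ < ξ × ∀ q → Prime q → νℤ q ξ ≡ lookup (exponentList (recoverAt q x)) i
  with-exponent i = ∃-with-νℤ (λ q → lookup (exponentList (recoverAt q x)) i) N λ q q-prime N<q →
    trans (cong (λ e → lookup (exponentList e) i) (vanish q q-prime N<q)) (lookup-replicate i 0)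
  ν≡ : ∀ i → ∀ q → Prime q → νℤ q (proj₁ (with-exponent i)) ≡ lookup (exponentList (recoverAt q x)) i
  ν≡ i = proj₂ (proj₂ (with-exponent i))

shape-resp : ∀ {e e′ t₁ t₁′ t₂ t₂′ tℓ} → e ≡ e′ → t₁ ≡ t₁′ → t₂ ≡ t₂′ → Shape e′ t₁′ t₂′ tℓ → Shape e t₁ t₂ tℓ
shape-resp refl refl refl s = s

shape-from-image : ∀ t → All Nonzero (vars t) → 𝓔 (Ψ t) → (∀ q → Prime q → recoverAt q (Ψ t) ≡ exponentsAt q t) →
                   ∀ q → Prime q → Shape (exponentsAt q t) (νℤ q (Param.τ₁ t)) (νℤ q (Param.τ₂ t)) (νℤ q (Param.τℓ t))
shape-from-image t@(param _ _ _ _ _ _ _ τ₁ τ₂ τℓ) t≢0 E recover≡ q q-prime =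
  shape-resp e≡ t₁≡ t₂≡ (Preimage.shape-of P)
  where
  P = surface⇒preimage (surface⇒local E q q-prime)
  e≡ : exponentsAt q t ≡ Preimage.e P
  e≡ = trans (sym (recover≡ q q-prime)) (recover-preimage P)
  t₂≡ : νℤ q τ₂ ≡ Preimage.t₂ P
  t₂≡ = ℕ.+-cancelˡ-≡ (exp₀ (Preimage.e P)) _ _ (begin
    exp₀ (Preimage.e P) ℕ.+ νℤ q τ₂       ≡⟨ cong (λ e → exp₀ e ℕ.+ νℤ q τ₂) e≡ ⟨
    νᵐ q (M₀ ⊗ τ₂ᵛ) (vars t)             ≡⟨ νℤ-⟦⟧ q-prime (M₀ ⊗ τ₂ᵛ) t≢0 ⟨
    νℤ q (⟦ M₀ ⊗ τ₂ᵛ ⟧ (vars t))         ≡⟨ Preimage.A≡ P ⟨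
    exp₀ (Preimage.e P) ℕ.+ Preimage.t₂ P ∎)
    where open ≡-Reasoning
  t₁≡ : νℤ q τ₁ ≡ Preimage.t₁ P
  t₁≡ = ℕ.+-cancelˡ-≡ (exp₃ (Preimage.e P)) _ _ (begin
    exp₃ (Preimage.e P) ℕ.+ νℤ q τ₁       ≡⟨ cong (λ e → exp₃ e ℕ.+ νℤ q τ₁) e≡ ⟨
    νᵐ q (M₃ ⊗ τ₁ᵛ) (vars t)             ≡⟨ νℤ-⟦⟧ q-prime (M₃ ⊗ τ₁ᵛ) t≢0 ⟨
    νℤ q (⟦ M₃ ⊗ τ₁ᵛ ⟧ (vars t))         ≡⟨ Preimage.C≡ P ⟨
    exp₃ (Preimage.e P) ℕ.+ Preimage.t₁ P ∎)
    where open ≡-Reasoning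

monomial-bounds : ∀ {a b u c ξ} → 𝓔 ⟨ a , b , u , c ⟩ → All Nonzero ξ →
                  (∀ q → Prime q → exponentsOf q ξ ≡ recoverAt q ⟨ a , b , u , c ⟩) → ∀ q → Prime q →
                  νℤ q (⟦ M₀ ⟧ ξ) ℕ.≤ νℤ q a × νℤ q (⟦ M₂ ⟧ ξ) ≡ νℤ q u × νℤ q (⟦ M₃ ⟧ ξ) ℕ.≤ νℤ q c
monomial-bounds {ξ = _ ∷ _ ∷ _ ∷ _ ∷ _ ∷ _ ∷ _ ∷ []} E ξ≢0 exponents≡ q q-prime =
    ℕ.≤-trans (ℕ.≤-reflexive (trans (νℤ-⟦⟧ q-prime M₀ ξ≢0) (cong exp₀ e≡))) (ℕ.≤-trans (ℕ.m≤m+n _ _) (ℕ.≤-reflexive (Preimage.A≡ P)))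
  , trans (νℤ-⟦⟧ q-prime M₂ ξ≢0) (trans (cong exp₂ e≡) (Preimage.U≡ P))
  , ℕ.≤-trans (ℕ.≤-reflexive (trans (νℤ-⟦⟧ q-prime M₃ ξ≢0) (cong exp₃ e≡))) (ℕ.≤-trans (ℕ.m≤m+n _ _) (ℕ.≤-reflexive (Preimage.C≡ P)))
  where
  P = surface⇒preimage (surface⇒local E q q-prime)
  e≡ = trans (exponents≡ q q-prime) (recover-preimage P)

⟨⟩-cong : ∀ {x₀ y₀ x₁ x₂ y₂ x₃ y₃} → x₀ ≡ y₀ → x₂ ≡ y₂ → x₃ ≡ y₃ → ⟨ x₀ , x₁ , x₂ , x₃ ⟩ ≡ ⟨ y₀ , x₁ , y₂ , y₃ ⟩
⟨⟩-cong refl refl refl = refl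

cofactors : ∀ {a b u c ξ} → 𝓔 ⟨ a , b , u , c ⟩ → All (0ℤ <_) ξ →
            (∀ q → Prime q → exponentsOf q ξ ≡ recoverAt q ⟨ a , b , u , c ⟩) →
            (Σ ℤ λ τ₂ → 0ℤ < τ₂ × a ≡ ⟦ M₀ ⟧ ξ * τ₂) × u ≡ ⟦ M₂ ⟧ ξ × (Σ ℤ λ τ₁ → c ≡ ⟦ M₃ ⟧ ξ * τ₁)
cofactors E@(_ , _ , a>0 , u>0 , _) ξ>0 exponents≡ =
    positive-factor (⟦⟧-positive M₀ ξ>0) a>0 (λ q q-prime → proj₁ (bounds q q-prime))
  , positive-≡ u>0 (⟦⟧-positive M₂ ξ>0) (λ q q-prime → sym (proj₁ (proj₂ (bounds q q-prime))))
  , factor (⟦⟧-nonzero M₃ ξ≢0) (lookup⁺ (𝓔⇒nonzero E) (# 3)) (λ q q-prime → proj₂ (proj₂ (bounds q q-prime)))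
  where
  ξ≢0 = All.map positive⇒nonzero ξ>0
  bounds = monomial-bounds E ξ≢0 exponents≡

record Realization (a b u c : ℤ) : Set where
  constructor realization
  field
    ξ          : Vec ℤ 7
    ξ>0        : All (0ℤ <_) ξ
    exponents≡ : ∀ q → Prime q → exponentsOf q ξ ≡ recoverAt q ⟨ a , b , u , c ⟩
    τ₁ τ₂      : ℤ
    τ₂>0       : 0ℤ < τ₂
    a≡M₀τ₂     : a ≡ ⟦ M₀ ⟧ ξ * τ₂
    u≡M₂       : u ≡ ⟦ M₂ ⟧ ξ
    c≡M₃τ₁     : c ≡ ⟦ M₃ ⟧ ξ * τ₁

realize : ∀ {a b u c} → 𝓔 ⟨ a , b , u , c ⟩ → Realization a b u c
realize E = realization ξ ξ>0 exponents≡ (proj₁ M₃τ₁) (proj₁ M₀τ₂) (proj₁ (proj₂ M₀τ₂)) (proj₂ (proj₂ M₀τ₂)) u≡M₂ (proj₂ M₃τ₁)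
  where
  R = realize-exponents _ E
  ξ = proj₁ R
  ξ>0 = proj₁ (proj₂ R)
  exponents≡ = proj₂ (proj₂ R)
  C = cofactors E ξ>0 exponents≡
  M₀τ₂ = proj₁ C
  u≡M₂ = proj₁ (proj₂ C)
  M₃τ₁ = proj₂ (proj₂ C)

realization⇒preimage : ∀ {a b u c} → 𝓔 ⟨ a , b , u , c ⟩ → Realization a b u c → Σ Param λ t → 𝓣₂ t × Ψ t ≡ ⟨ a , b , u , c ⟩
realization⇒preimage {a} {b} {u} {c} E@(_ , _ , _ , _ , surface≡0)
  (realization ξ@(ξ₁ ∷ ξ₂ ∷ ξ₃ ∷ ξℓ ∷ ξ₄ ∷ ξ₅ ∷ ξ₆ ∷ []) ξ>0@(h₁ ∷ h₂ ∷ h₃ ∷ hℓ ∷ h₄ ∷ h₅ ∷ h₆ ∷ []) exponents≡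
               τ₁ τ₂ τ₂>0 a≡M₀τ₂ u≡M₂ c≡M₃τ₁) =
  t , ((h₁ , h₂ , h₃ , hℓ , h₄ , h₅ , h₆) , nonzero⇒≢0 τ₁≢0 , τ₂>0 , nonzero⇒≢0 b≢0 , torsor≡0 , coprime) , Ψt≡x
  where
  ξ≢0 = All.map positive⇒nonzero ξ>0
  b≢0 = lookup⁺ (𝓔⇒nonzero E) (# 1)
  τ₁≢0 = proj₂ (nonzero-*⁻¹ (⟦ M₃ ⟧ ξ) τ₁ (subst Nonzero c≡M₃τ₁ (lookup⁺ (𝓔⇒nonzero E) (# 3))))
  t = param ξ₁ ξ₂ ξ₃ ξℓ ξ₄ ξ₅ ξ₆ τ₁ τ₂ b
  Ψt≡x : Ψ t ≡ ⟨ a , b , u , c ⟩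
  Ψt≡x = ⟨⟩-cong (sym a≡M₀τ₂) (sym u≡M₂) (sym c≡M₃τ₁)
  t≢0 : All Nonzero (vars t)
  t≢0 = ++⁺ ξ≢0 (τ₁≢0 ∷ positive⇒nonzero τ₂>0 ∷ b≢0 ∷ [])
  torsor≡0 : torsor t ≡ 0ℤ
  torsor≡0 = nonzero*j≡0⇒j≡0 (torsor t) (⟦⟧-nonzero K t≢0)
                (trans (sym (surface∘Ψ t)) (trans (cong surface Ψt≡x) surface≡0))
  coprime : CoprimeConditions t
  coprime = local⇒coprimality t t≢0 λ q q-prime →
    shape⇒coprimality (shape-from-image t t≢0 (subst 𝓔 (sym Ψt≡x) E)
                        (λ q q-prime → trans (cong (recoverAt q) Ψt≡x) (sym (exponents≡ q q-prime))) q q-prime)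

Ψ-onto : ∀ x → 𝓔 x → Σ Param λ t → 𝓣₂ t × Ψ t ≡ x
Ψ-onto ⟨ a , b , u , c ⟩ E = realization⇒preimage E (realize E)

lemma14 : ((t : Param) → 𝓣₂ t → 𝓔 (Ψ t))
    × ((s t : Param) → 𝓣₂ s → 𝓣₂ t → Ψ s ≡ Ψ t → s ≡ t)
    × ((x : ℤ⁴) → 𝓔 x → Σ Param (λ t → 𝓣₂ t × Ψ t ≡ x))
lemma14 = Ψ-into , Ψ-injective , Ψ-onto
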